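{- Let $n$ be a square-free odd positive integer with $n^2+1 = 2q$ for a prime $q$, and let $E_n: y^2 = x(x-1)(x+n^2)$. Let $(b_1,b_2)$ be a pair of square-free integers with $b_1>0$, $b_2>0$, $b_2$ odd, all of whose prime factors lie in $\{2,q\}\cup\{\text{primes dividing } n\}$, and suppose $(b_1,b_2)\in S^{(2)}(E_n/\mathbb{Q})$. Then for an arbitrary prime $p$: [a] if $p \mid b_1$ then $p \equiv 1$ or $5 \pmod 8$; [b] $b_2 \in \{1,q\}$; moreover, if $n$ has a prime divisor $p\equiv 5 \pmod 8$, then $(1,q)\notin S^{(2)}(E_n/\mathbb{Q})$; [c] the number of prime factors of $b_1$ congruent to $5 \pmod 8$ is even.
   Context: Via the $2$-descent map $(x,y)\mapsto (x \bmod \mathbb{Q}^{*2},\ (x-1) \bmod \mathbb{Q}^{*2})$, elements of the $2$-Selmer group $S^{(2)}(E_n/\mathbb{Q})$ are identified with pairs $(b_1,b_2)$ of square-free integers (prime factors among $2$, $q$ and the primes dividing $n$) such that the curve $C_{b_1,b_2}$ defined by $b_1z_1^2 - b_2z_2^2 = 1$, $b_1z_1^2 - b_1b_2z_3^2 = -n^2$ has a point over $\mathbb{R}$ and over $\mathbb{Q}_l$ for every prime $l$. The hypotheses $b_1,b_2>0$ and $b_2$ odd are the paper's standing normalization of representatives modulo the image of torsion. -}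

module Defs where

open import Data.Nat as ℕ using (ℕ; suc; _%_)
open import Data.Nat.Divisibility as ℕD using ()
open import Data.Nat.Primality using (Prime; prime?)
open import Data.Integer as ℤ using (ℤ; +_; ∣_∣; -_; _*_; _-_; _+_; _≤_; _^_)
open import Data.Integer.Divisibility using (_∣_)
open import Data.List using (List; filter; length; upTo)
open import Data.Product using (Σ; ∃; _×_)
open import Data.Sum using (_⊎_)
open import Relation.Nullary using (¬_)
open import Relation.Nullary.Decidable using (_×-dec_)
open import Relation.Binary.PropositionalEquality using (_≡_)

-- b is square-free: no square of a prime divides b (in particular b ≠ 0).
SquareFree : ℤ → Set
SquareFree b = ∀ (p : ℕ) → Prime p → ¬ ((+ p) * (+ p) ∣ b)

SupportedOn : ℕ → ℕ → ℤ → Set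
SupportedOn n q b = ∀ (p : ℕ) → Prime p → (+ p) ∣ b →
  (p ≡ 2) ⊎ (p ≡ q) ⊎ (p ℕD.∣ n)

-- l-adic integers as coherent sequences of residues (inverse limit of ℤ/l^k)

record ℤ[_] (l : ℕ) : Set where
  field
    seq : ℕ → ℤ
    coh : ∀ k → (+ l) ^ k ∣ (seq (suc k) - seq k)
open ℤ[_] public

-- Local solvability of  C_{b1,b2} : b1 z1² - b2 z2² = 1 ,  b1 z1² - b1 b2 z3² = -n²

-- A Q_l-point: z_i = u_i / l^e with u_i ∈ ℤ_l; the two equations, after
-- multiplying by l^{2e}, hold in ℤ_l, i.e. modulo l^k for every k.
HasQlPoint : ℕ → ℤ → ℤ → ℕ → Set
HasQlPoint n b1 b2 l =
  Σ ℕ λ e → Σ ℤ[ l ] λ u1 → Σ ℤ[ l ] λ u2 → Σ ℤ[ l ] λ u3 →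
    ∀ (k : ℕ) →
      let x1 = seq u1 k ; x2 = seq u2 k ; x3 = seq u3 k
          L  = (+ l) ^ (e ℕ.+ e)
      in ((+ l) ^ k ∣ (b1 * x1 * x1 - b2 * x2 * x2 - L))
       × ((+ l) ^ k ∣ (b1 * x1 * x1 - b1 * b2 * x3 * x3 + (+ n) * (+ n) * L))

-- An ℝ-point: some z1 (taken rational, z1 = a/d) for which the values
-- z2² = (b1 z1² - 1)/b2 and z3² = (b1 z1² + n²)/(b1 b2) are ≥ 0 (so that
-- real square roots z2, z3 exist).
HasRealPoint : ℕ → ℤ → ℤ → Set
HasRealPoint n b1 b2 =
  Σ ℤ λ a → Σ ℕ λ d → (1 ℕ.≤ d) ×
    (+ 0 ≤ b2 * (b1 * a * a - (+ d) * (+ d))) ×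
    (+ 0 ≤ b1 * b2 * (b1 * a * a + (+ n) * (+ n) * (+ d) * (+ d)))

-- (b1,b2) ∈ S^(2)(E_n/Q) via the 2-descent identification.
InSelmer : ℕ → ℕ → ℤ → ℤ → Set
InSelmer n q b1 b2 =
  SquareFree b1 × SquareFree b2 × SupportedOn n q b1 × SupportedOn n q b2 ×
  HasRealPoint n b1 b2 × (∀ (l : ℕ) → Prime l → HasQlPoint n b1 b2 l)

primeFactors5mod8 : ℕ → List ℕ
primeFactors5mod8 m =
  filter (λ p → prime? p ×-dec (p ℕD.∣? m) ×-dec (p % 8 ℕ.≟ 5)) (upTo (suc m))

EvenNat : ℕ → Set
EvenNat k = ∃ λ j → k ≡ j ℕ.+ j

-- Every conclusion is a congruence forced by solvability of C_{b1,b2} over a single Qₗ.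
-- Clearing denominators and dividing out common factors of l, a Qₗ-point becomes an integral
-- solution of the homogenised equations that is either l-integral or primitive with l² dividing
-- the scale, and reducing modulo l³ gives: b1 is odd and b2 is prime to n; a prime of b1 dividing
-- n makes -1 a square modulo it, hence it is ≡ 1 (mod 4), like q = (n² + 1)/2; for l = 2,
-- b2 ≡ 1 (mod 4) forces b1 ≡ 1 (mod 8); and a point of C_{1,q} at l ∣ n makes 2 or -2 a square
-- modulo l, which Euler's criterion and Gauss's count (2 is a non-residue) exclude for
-- l ≡ 5 (mod 8).  Finally, as 5² ≡ 1 (mod 8), b1 ≡ 1 (mod 8) means that b1 has an even number of
-- prime factors ≡ 5 (mod 8).

module Submission where

open import Defs
open import Data.Empty using (⊥; ⊥-elim)
open import Data.Fin using (Fin; toℕ; fromℕ; inject₁) renaming (zero to fzero; suc to fsuc)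
import Data.Fin.Properties as FinP
open import Data.Integer as ℤ using (ℤ; +_; -[1+_]; ∣_∣; -_; _+_; _-_; _*_; _^_; 1ℤ; -1ℤ; 0ℤ)
import Data.Integer.DivMod as ℤDM
open import Data.Integer.Divisibility using (_∣_)
open import Data.Integer.Divisibility.Signed as ℤD using (divides) renaming (_∣_ to _∣ₛ_)
import Data.Integer.Properties as ℤP
open import Data.Integer.Tactic.RingSolver using (solve-∀)
open import Data.List using (List; []; _∷_; filter; length; upTo; _++_)
import Data.List.Properties as ListP
open import Data.List.Relation.Unary.All using (_∷_)
open import Data.Nat as ℕ using (ℕ; zero; suc; _%_; _≤_; _<_)
open import Data.Nat.Combinatorics using (_C_; nCn≡1; k![n∸k]!∣n!; nCk≡n!/k![n-k]!)
open import Data.Nat.Divisibility as ℕD using ()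
import Data.Nat.DivMod as ℕDM
open import Data.Nat.Induction using (<-rec)
open import Data.Nat.Primality
  using (Prime; prime?; prime[2]; euclidsLemma; prime⇒irreducible; ¬prime[1]; prime⇒nonZero; prime⇒nonTrivial)
open import Data.Nat.Primality.Factorisation using (factorise)
import Data.Nat.Properties as ℕP
import Data.Nat.Tactic.RingSolver as ℕSolver
open import Data.Product using (Σ; ∃; _×_; _,_; proj₁; proj₂; uncurry)
open import Data.Sum as Sum using (_⊎_; inj₁; inj₂; [_,_]′)
open import Data.Vec.Functional using (init; tail)
open import Function using (_∘′_; case_of_)
open import Level using (0ℓ)
open import Relation.Binary.PropositionalEquality
open import Relation.Nullary using (¬_; Dec; yes; no)
open import Relation.Nullary.Decidable using (map′; _×-dec_; toSum)
open import Relation.Unary using (Pred; Decidable)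
open import Algebra.Definitions.RawMonoid ℤ.+-0-rawMonoid using (sum) renaming (_×_ to _·ˢ_)
open import Algebra.Properties.CommutativeSemigroup ℕP.+-commutativeSemigroup using () renaming (interchange to +-interchange)
import Algebra.Properties.CommutativeSemiring.Binomial ℤP.+-*-commutativeSemiring as Binomial
open import Algebra.Properties.Monoid.Sum ℤP.+-0-monoid using (sum-init-last)
open import Algebra.Properties.Semiring.Exp ℤP.+-*-semiring using () renaming (_^_ to _^ˢ_)

-- Divisibility in ℤ and Fermat's little theorem

∣-linear₂ : ∀ {m A B C} → m ∣ₛ A → m ∣ₛ B → ∀ α β → C ≡ α * A + β * B → m ∣ₛ C
∣-linear₂ dA dB α β refl = ℤD.∣m∣n⇒∣m+n (ℤD.∣n⇒∣m*n α dA) (ℤD.∣n⇒∣m*n β dB)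

∣-linear₃ : ∀ {m A B D C} → m ∣ₛ A → m ∣ₛ B → m ∣ₛ D → ∀ α β γ →
            C ≡ α * A + β * B + γ * D → m ∣ₛ C
∣-linear₃ dA dB dD α β γ refl = ℤD.∣m∣n⇒∣m+n (∣-linear₂ dA dB α β refl) (ℤD.∣n⇒∣m*n γ dD)

∣-linear₄ : ∀ {m A B D E C} → m ∣ₛ A → m ∣ₛ B → m ∣ₛ D → m ∣ₛ E → ∀ α β γ δ →
            C ≡ α * A + β * B + γ * D + δ * E → m ∣ₛ C
∣-linear₄ dA dB dD dE α β γ δ refl =
  ℤD.∣m∣n⇒∣m+n (∣-linear₃ dA dB dD α β γ refl) (ℤD.∣n⇒∣m*n δ dE)

∣-self : ∀ {m} c → m ∣ₛ c * m
∣-self c = divides c refl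

∣0 : ∀ {m} → m ∣ₛ 0ℤ
∣0 {m} = divides 0ℤ (sym (ℤP.*-zeroˡ m))

≡⇒∣- : ∀ {m a b} → a ≡ b → m ∣ₛ a - b
≡⇒∣- {m} {a} refl = subst (m ∣ₛ_) (sym (ℤP.+-inverseʳ a)) ∣0

∣-pow-cong : ∀ {m a b} k → m ∣ₛ a - b → m ∣ₛ a ^ k - b ^ k
∣-pow-cong zero _ = ∣0
∣-pow-cong {m} {a} {b} (suc k) d = ∣-linear₂ (∣-pow-cong k d) d a (b ^ k) (identity a b (a ^ k) (b ^ k))
  where
  identity : ∀ a b A B → a * A - b * B ≡ a * (A - B) + B * (a - b)
  identity = solve-∀

_∣?ₛ_ : ∀ p a → Dec (+ p ∣ₛ a)
p ∣?ₛ a = map′ ℤD.∣ᵤ⇒∣ ℤD.∣⇒∣ᵤ (p ℕD.∣? ∣ a ∣)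

prime>1 : ∀ {p} → Prime p → 1 ℕ.< p
prime>1 {p} pr = ℕ.nonTrivial⇒n>1 p {{prime⇒nonTrivial pr}}

prime∤1 : ∀ {p} → Prime p → ¬ (+ p ∣ₛ 1ℤ)
prime∤1 pr d = ℕP.<⇒≱ (prime>1 pr) (ℕD.∣⇒≤ (ℤD.∣⇒∣ᵤ d))

prime∣-* : ∀ {p a b} → Prime p → + p ∣ₛ a * b → + p ∣ₛ a ⊎ + p ∣ₛ b
prime∣-* {p} {a} {b} pr d
  with euclidsLemma ∣ a ∣ ∣ b ∣ pr (subst (p ℕD.∣_) (ℤP.abs-* a b) (ℤD.∣⇒∣ᵤ d))
... | inj₁ p∣a = inj₁ (ℤD.∣ᵤ⇒∣ p∣a)
... | inj₂ p∣b = inj₂ (ℤD.∣ᵤ⇒∣ p∣b)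

prime∣-square : ∀ {p a} → Prime p → + p ∣ₛ a * a → + p ∣ₛ a
prime∣-square pr d with prime∣-* pr d
... | inj₁ p∣a = p∣a
... | inj₂ p∣a = p∣a

prime∤factorial : ∀ {p m} → Prime p → m ℕ.< p → ¬ (p ℕD.∣ m ℕ.!)
prime∤factorial {m = zero} pr _ d = ℕP.<⇒≱ (prime>1 pr) (ℕD.∣⇒≤ d)
prime∤factorial {m = suc m} pr m<p d with euclidsLemma (suc m) (m ℕ.!) pr d
... | inj₁ p∣m+1 = ℕP.<⇒≱ m<p (ℕD.∣⇒≤ p∣m+1)
... | inj₂ p∣m! = prime∤factorial pr (ℕP.<-trans (ℕP.n<1+n m) m<p) p∣m!

prime∣binomial : ∀ {p k} → Prime p → 0 ℕ.< k → k ℕ.< p → p ℕD.∣ p C k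
prime∣binomial {p@(suc p-1)} {k} pr 0<k k<p
  with euclidsLemma (p C k) (k ℕ.! ℕ.* (p ℕ.∸ k) ℕ.!) pr p∣product
  where
  instance _ = ℕP.m*n≢0 (k ℕ.!) ((p ℕ.∸ k) ℕ.!) {{ℕP._!≢0 k}} {{ℕP._!≢0 (p ℕ.∸ k)}}
  p∣product : p ℕD.∣ (p C k) ℕ.* (k ℕ.! ℕ.* (p ℕ.∸ k) ℕ.!)
  p∣product = subst (p ℕD.∣_)
    (sym (trans (cong (ℕ._* (k ℕ.! ℕ.* (p ℕ.∸ k) ℕ.!)) (nCk≡n!/k![n-k]! (ℕP.<⇒≤ k<p)))
                (ℕDM.m/n*n≡m (k![n∸k]!∣n! (ℕP.<⇒≤ k<p)))))
    (ℕD.m∣m*n (p-1 ℕ.!))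
... | inj₁ p∣pCk = p∣pCk
... | inj₂ p∣k![p-k]! with euclidsLemma (k ℕ.!) ((p ℕ.∸ k) ℕ.!) pr p∣k![p-k]!
...   | inj₁ p∣k! = ⊥-elim (prime∤factorial pr k<p p∣k!)
...   | inj₂ p∣[p-k]! = ⊥-elim (prime∤factorial pr (ℕP.∸-monoʳ-< 0<k (ℕP.<⇒≤ k<p)) p∣[p-k]!)

∣-sum : ∀ {d n} (g : Fin n → ℤ) → (∀ i → d ∣ₛ g i) → d ∣ₛ sum g
∣-sum {n = zero} g _ = ∣0
∣-sum {n = suc n} g d∣g = ℤD.∣m∣n⇒∣m+n (d∣g fzero) (∣-sum (tail g) (λ i → d∣g (fsuc i)))

^ˢ≡^ : ∀ x n → x ^ˢ n ≡ x ^ n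
^ˢ≡^ x zero = refl
^ˢ≡^ x (suc n) = cong (x *_) (^ˢ≡^ x n)

binomialTerm≡ : ∀ a p k →
  Binomial.binomialTerm a 1ℤ p k ≡ + (p C toℕ k) * (a ^ toℕ k * 1ℤ ^ (p ℕ.∸ toℕ k))
binomialTerm≡ a p k = trans (·ˢ≡* (p C toℕ k) _)
  (cong (+ (p C toℕ k) *_) (cong₂ _*_ (^ˢ≡^ a (toℕ k)) (^ˢ≡^ 1ℤ (p ℕ.∸ toℕ k))))
  where
  ·ˢ≡* : ∀ n x → n ·ˢ x ≡ + n * x
  ·ˢ≡* zero x = sym (ℤP.*-zeroˡ x)
  ·ˢ≡* (suc n) x = trans (cong (_+_ x) (·ˢ≡* n x)) (sym (trans (cong (_* x) (ℤP.pos-+ 1 n))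
    (trans (ℤP.*-distribʳ-+ x 1ℤ (+ n)) (cong (_+ + n * x) (ℤP.*-identityˡ x)))))

prime∣[a+1]^p-[a^p+1] : ∀ {p} → Prime p → ∀ a → + p ∣ₛ (a + 1ℤ) ^ p - (a ^ p + 1ℤ)
prime∣[a+1]^p-[a^p+1] {p@(suc p-1)} pr a = subst (+ p ∣ₛ_) expansion (∣-sum (init (tail t)) p∣middle)
  where
  t = Binomial.binomialTerm a 1ℤ p
  p∣middle : ∀ i → + p ∣ₛ t (fsuc (inject₁ i))
  p∣middle i = let k = fsuc (inject₁ i) in subst (+ p ∣ₛ_) (sym (binomialTerm≡ a p k))
    (ℤD.∣m⇒∣m*n (a ^ toℕ k * 1ℤ ^ (p ℕ.∸ toℕ k)) (ℤD.∣ᵤ⇒∣ {+ p} {+ (p C toℕ k)}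
      (prime∣binomial pr (ℕ.s≤s ℕ.z≤n)
      (ℕ.s≤s (subst (ℕ._< p-1) (sym (FinP.toℕ-inject₁ i)) (FinP.toℕ<n i))))))
  first : t fzero ≡ 1ℤ
  first = trans (binomialTerm≡ a p fzero) (cong (λ x → + 1 * (1ℤ * x)) (ℤP.^-zeroˡ p))
  last : t (fsuc (fromℕ p-1)) ≡ a ^ p
  last = trans (binomialTerm≡ a p (fsuc (fromℕ p-1))) (top (toℕ (fromℕ p-1)) (FinP.toℕ-fromℕ p-1))
    where
    top : ∀ j → j ≡ p-1 → + (p C suc j) * (a ^ suc j * 1ℤ ^ (p ℕ.∸ suc j)) ≡ a ^ p
    top j refl rewrite nCn≡1 p | ℕP.n∸n≡0 p-1 = trans (ℤP.*-identityˡ _) (ℤP.*-identityʳ _)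
  rearrange : ∀ x s y → x ≡ 1ℤ + (s + y) → s ≡ x - (y + 1ℤ)
  rearrange _ s y refl = identity s y
    where
    identity : ∀ s y → s ≡ 1ℤ + (s + y) - (y + 1ℤ)
    identity = solve-∀
  expansion : sum (init (tail t)) ≡ (a + 1ℤ) ^ p - (a ^ p + 1ℤ)
  expansion = rearrange _ _ _ (begin
    (a + 1ℤ) ^ p                        ≡⟨ trans (sym (^ˢ≡^ (a + 1ℤ) p)) (Binomial.theorem p a 1ℤ) ⟩
    t fzero + sum (tail t)              ≡⟨ cong₂ _+_ first (sum-init-last (tail t)) ⟩
    1ℤ + (middle + t (fsuc (fromℕ p-1))) ≡⟨ cong (λ x → 1ℤ + (middle + x)) last ⟩
    1ℤ + (middle + a ^ p)               ∎)
    where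
    open ≡-Reasoning
    middle = sum (init (tail t))

fermat-little : ∀ {p} → Prime p → ∀ a → + p ∣ₛ a ^ p - a
fermat-little {p@(suc p-1)} pr a =
  ∣-linear₃ (∣-pow-cong {a = a} {+ r} p a≡r) (natural r) a≡r 1ℤ 1ℤ -1ℤ (identity (a ^ p) ((+ r) ^ p) a (+ r))
  where
  instance _ = prime⇒nonZero pr
  r = a ℤ.%ℕ p
  a≡r : + p ∣ₛ a - + r
  a≡r = divides (a ℤ./ℕ p) (trans (cong (_- + r) (ℤDM.a≡a%ℕn+[a/ℕn]*n a p)) (shift (+ r) _))
    where
    shift : ∀ x y → x + y - x ≡ y
    shift = solve-∀
  identity : ∀ A B a b → A - a ≡ 1ℤ * (A - B) + 1ℤ * (B - b) + -1ℤ * (a - b)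
  identity = solve-∀
  natural : ∀ m → + p ∣ₛ (+ m) ^ p - + m
  natural zero = subst (+ p ∣ₛ_) (sym (cong (_- 0ℤ) (ℤP.*-zeroˡ (0ℤ ^ p-1)))) ∣0
  natural (suc m) = subst (λ x → + p ∣ₛ x ^ p - x) (trans (sym (ℤP.pos-+ m 1)) (cong (λ x → + x) (ℕP.+-comm m 1)))
    (∣-linear₂ (prime∣[a+1]^p-[a^p+1] pr (+ m)) (natural m) 1ℤ 1ℤ (step ((+ m + 1ℤ) ^ p) ((+ m) ^ p) (+ m)))
    where
    step : ∀ A B x → A - (x + 1ℤ) ≡ 1ℤ * (A - (B + 1ℤ)) + 1ℤ * (B - x)
    step = solve-∀

fermat : ∀ {p a} → Prime p → ¬ (+ p ∣ₛ a) → + p ∣ₛ a ^ (p ℕ.∸ 1) - 1ℤ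
fermat {suc p-1} {a} pr p∤a =
  [ (λ p∣a → ⊥-elim (p∤a p∣a)) , (λ p∣a^[p-1]-1 → p∣a^[p-1]-1) ]′
    (prime∣-* pr (subst (+ suc p-1 ∣ₛ_) (factor a (a ^ p-1)) (fermat-little pr a)))
  where
  factor : ∀ a A → a * A - a ≡ a * (A - 1ℤ)
  factor = solve-∀

-- The quadratic characters of -1 and ±2

^-distrib-* : ∀ a b n → (a * b) ^ n ≡ a ^ n * b ^ n
^-distrib-* a b zero = refl
^-distrib-* a b (suc n) = trans (cong (a * b *_) (^-distrib-* a b n)) (swap a b (a ^ n) (b ^ n))
  where
  swap : ∀ a b A B → a * b * (A * B) ≡ a * A * (b * B)
  swap = solve-∀

^-double : ∀ a h → a ^ (h ℕ.+ h) ≡ (a * a) ^ h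
^-double a h = trans (ℤP.^-distribˡ-+-* a h h) (sym (^-distrib-* a a h))

∣2⇒≤2 : ∀ {p} → + p ∣ₛ + 2 → p ℕ.≤ 2
∣2⇒≤2 d = ℕD.∣⇒≤ (ℤD.∣⇒∣ᵤ d)

euler-criterion : ∀ {p u v t} h → Prime p → p ≡ suc (h ℕ.+ h) → ¬ (+ p ∣ₛ t) → ¬ (+ p ∣ₛ v) →
                  + p ∣ₛ u * u - t * (v * v) → + p ∣ₛ t ^ h - 1ℤ
euler-criterion {p} {u} {v} {t} h pr refl p∤t p∤v p∣u²-tv² =
  ∣-linear₃ (fermat-square v p∤v) (fermat-square u p∤u) p∣U-TV (- t ^ h) 1ℤ -1ℤ
    (identity ((u * u) ^ h) ((v * v) ^ h) (t ^ h))
  where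
  p∣U-TV : + p ∣ₛ (u * u) ^ h - t ^ h * (v * v) ^ h
  p∣U-TV = subst (λ x → + p ∣ₛ (u * u) ^ h - x) (^-distrib-* t (v * v) h)
    (∣-pow-cong {a = u * u} {b = t * (v * v)} h p∣u²-tv²)
  fermat-square : ∀ a → ¬ (+ p ∣ₛ a) → + p ∣ₛ (a * a) ^ h - 1ℤ
  fermat-square a p∤a = subst (λ x → + p ∣ₛ x - 1ℤ) (^-double a h) (fermat pr p∤a)
  p∤u : ¬ (+ p ∣ₛ u)
  p∤u p∣u with prime∣-* pr (∣-linear₂ p∣u²-tv² p∣u -1ℤ u (rearrange u t v))
    where
    rearrange : ∀ u t v → t * (v * v) ≡ -1ℤ * (u * u - t * (v * v)) + u * u
    rearrange = solve-∀
  ... | inj₁ p∣t = p∤t p∣t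
  ... | inj₂ p∣v² = p∤v (prime∣-square pr p∣v²)
  identity : ∀ U V T → T - 1ℤ ≡ - T * (V - 1ℤ) + 1ℤ * (U - 1ℤ) + -1ℤ * (U - T * V)
  identity = solve-∀

∏ : (ℕ → ℤ) → ℕ → ℤ
∏ f zero = 1ℤ
∏ f (suc n) = ∏ f n * f n

∏-shiftˡ : ∀ f n → ∏ f (suc n) ≡ f 0 * ∏ (λ i → f (suc i)) n
∏-shiftˡ f zero = trans (ℤP.*-identityˡ (f 0)) (sym (ℤP.*-identityʳ (f 0)))
∏-shiftˡ f (suc n) = trans (cong (_* f (suc n)) (∏-shiftˡ f n)) (ℤP.*-assoc (f 0) _ _)

∏-reverse : ∀ f n → ∏ (λ i → f (n ℕ.∸ suc i)) n ≡ ∏ f n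
∏-reverse f zero = refl
∏-reverse f (suc n) = trans (∏-shiftˡ (λ i → f (suc n ℕ.∸ suc i)) n)
  (trans (cong (f n *_) (∏-reverse f n)) (ℤP.*-comm (f n) _))

∏-split : ∀ f m n → ∏ f (m ℕ.+ n) ≡ ∏ f m * ∏ (λ i → f (m ℕ.+ i)) n
∏-split f m zero = trans (cong (∏ f) (ℕP.+-identityʳ m)) (sym (ℤP.*-identityʳ _))
∏-split f m (suc n) = trans (cong (∏ f) (ℕP.+-suc m n))
  (trans (cong (_* f (m ℕ.+ n)) (∏-split f m n)) (ℤP.*-assoc (∏ f m) _ _))

∏-neg : ∀ f n → ∏ (λ i → - f i) n ≡ -1ℤ ^ n * ∏ f n
∏-neg f zero = refl
∏-neg f (suc n) = trans (cong (_* - f n) (∏-neg f n)) (identity (-1ℤ ^ n) (∏ f n) (f n))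
  where
  identity : ∀ s P a → s * P * - a ≡ -1ℤ * s * (P * a)
  identity = solve-∀

∏-cong-mod : ∀ {d f g} n → (∀ i → i ℕ.< n → d ∣ₛ f i - g i) → d ∣ₛ ∏ f n - ∏ g n
∏-cong-mod zero _ = ∣0
∏-cong-mod {f = f} {g} (suc n) f≡g =
  ∣-linear₂ (∏-cong-mod n (λ i i<n → f≡g i (ℕP.m<n⇒m<1+n i<n))) (f≡g n (ℕP.n<1+n n)) (f n) (∏ g n)
    (identity (∏ f n) (∏ g n) (f n) (g n))
  where
  identity : ∀ P Q a b → P * a - Q * b ≡ a * (P - Q) + Q * (a - b)
  identity = solve-∀

∏-succ≡factorial : ∀ n → ∏ (λ i → + i + 1ℤ) n ≡ + (n ℕ.!)
∏-succ≡factorial zero = refl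
∏-succ≡factorial (suc n) = begin
  ∏ (λ i → + i + 1ℤ) n * (+ n + 1ℤ) ≡⟨ cong₂ _*_ (∏-succ≡factorial n) (sym (ℤP.pos-+ n 1)) ⟩
  + (n ℕ.!) * + (n ℕ.+ 1)           ≡⟨ sym (ℤP.pos-* (n ℕ.!) (n ℕ.+ 1)) ⟩
  + (n ℕ.! ℕ.* (n ℕ.+ 1))           ≡⟨ cong (λ x → + x) (ℕP.*-comm (n ℕ.!) (n ℕ.+ 1)) ⟩
  + ((n ℕ.+ 1) ℕ.* n ℕ.!)           ≡⟨ cong (λ m → + (m ℕ.* n ℕ.!)) (ℕP.+-comm n 1) ⟩
  + (suc n ℕ.!)                     ∎
  where open ≡-Reasoning

evens odds : ℕ → ℤ
evens i = + 2 * (+ i + 1ℤ)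
odds i = + 2 * + i + 1ℤ

∏-evens : ∀ n → ∏ evens n ≡ (+ 2) ^ n * ∏ (λ i → + i + 1ℤ) n
∏-evens zero = refl
∏-evens (suc n) = trans (cong (_* evens n) (∏-evens n)) (identity ((+ 2) ^ n) (∏ (λ i → + i + 1ℤ) n) (+ n))
  where
  identity : ∀ T P x → T * P * (+ 2 * (x + 1ℤ)) ≡ + 2 * T * (P * (x + 1ℤ))
  identity = solve-∀

∏-succ-double : ∀ k → ∏ (λ i → + i + 1ℤ) (k ℕ.+ k) ≡ ∏ evens k * ∏ odds k
∏-succ-double zero = refl
∏-succ-double (suc k) rewrite ℕP.+-suc k k | ∏-succ-double k | ℤP.pos-+ k k
  | ℤP.pos-+ 1 (k ℕ.+ k) | ℤP.pos-+ k k = identity (∏ evens k) (∏ odds k) (+ k)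
  where
  identity : ∀ E O x → E * O * (x + x + 1ℤ) * ((1ℤ + (x + x)) + 1ℤ) ≡ E * (+ 2 * (x + 1ℤ)) * (O * (+ 2 * x + 1ℤ))
  identity = solve-∀

-- Gauss: modulo p = 4k + 1 the even numbers 2k + 2, …, 4k are ≡ -(2k - 1), …, -3, -1, so
-- 2^(2k) (2k)! = 2 · 4 ⋯ 4k ≡ (-1)^k (2k)!.
prime∣2^[2k]-[-1]^k : ∀ {p} k → Prime p → p ≡ suc (k ℕ.+ k ℕ.+ (k ℕ.+ k)) → + p ∣ₛ (+ 2) ^ (k ℕ.+ k) - -1ℤ ^ k
prime∣2^[2k]-[-1]^k {p} k pr p≡4k+1 =
  [ (λ p∣[2k]! → ⊥-elim (prime∤factorial pr 2k<p
      (ℤD.∣⇒∣ᵤ (subst (+ p ∣ₛ_) (∏-succ≡factorial (k ℕ.+ k)) p∣[2k]!))))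
  , (λ p∣2^[2k]-[-1]^k → p∣2^[2k]-[-1]^k) ]′ (prime∣-* pr p∣[2k]!·[2^[2k]-[-1]^k])
  where
  E = ∏ evens k
  O = ∏ odds k
  A = ∏ (λ i → evens (k ℕ.+ i)) k
  2k<p : k ℕ.+ k ℕ.< p
  2k<p = subst (k ℕ.+ k ℕ.<_) (sym p≡4k+1) (ℕ.s≤s (ℕP.m≤m+n (k ℕ.+ k) (k ℕ.+ k)))
  p≡4k+1ℤ : + p ≡ + 4 * + k + 1ℤ
  p≡4k+1ℤ = begin
    + p                               ≡⟨ cong (λ x → + x) p≡4k+1 ⟩
    + suc (k ℕ.+ k ℕ.+ (k ℕ.+ k))     ≡⟨ ℤP.pos-+ 1 (k ℕ.+ k ℕ.+ (k ℕ.+ k)) ⟩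
    1ℤ + + (k ℕ.+ k ℕ.+ (k ℕ.+ k))
      ≡⟨ cong (_+_ 1ℤ) (trans (ℤP.pos-+ (k ℕ.+ k) (k ℕ.+ k)) (cong₂ _+_ (ℤP.pos-+ k k) (ℤP.pos-+ k k))) ⟩
    1ℤ + (+ k + + k + (+ k + + k))    ≡⟨ identity (+ k) ⟩
    + 4 * + k + 1ℤ                    ∎
    where
    open ≡-Reasoning
    identity : ∀ x → 1ℤ + (x + x + (x + x)) ≡ + 4 * x + 1ℤ
    identity = solve-∀
  upper≡-odd : ∀ i → i ℕ.< k → + p ∣ₛ evens (k ℕ.+ i) - - odds (k ℕ.∸ suc i)
  upper≡-odd i i<k = divides 1ℤ (begin
    evens (k ℕ.+ i) - - odds d                    ≡⟨ cong (λ x → + 2 * (x + 1ℤ) - - odds d) (ℤP.pos-+ k i) ⟩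
    + 2 * (+ k + + i + 1ℤ) - - odds d             ≡⟨ cong (λ x → + 2 * (x + + i + 1ℤ) - - odds d) k≡i+d+1 ⟩
    + 2 * (+ i + + d + 1ℤ + + i + 1ℤ) - - odds d  ≡⟨ identity (+ i) (+ d) ⟩
    1ℤ * (+ 4 * (+ i + + d + 1ℤ) + 1ℤ)            ≡⟨ cong (λ x → 1ℤ * (+ 4 * x + 1ℤ)) k≡i+d+1 ⟨
    1ℤ * (+ 4 * + k + 1ℤ)                         ≡⟨ cong (1ℤ *_) p≡4k+1ℤ ⟨
    1ℤ * + p                                      ∎)
    where
    open ≡-Reasoning
    d = k ℕ.∸ suc i
    k≡i+d+1 : + k ≡ + i + + d + 1ℤ
    k≡i+d+1 = begin
      + k                 ≡⟨ cong (λ x → + x) (ℕP.m+[n∸m]≡n i<k) ⟨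
      + (suc i ℕ.+ d)     ≡⟨ trans (ℤP.pos-+ (suc i) d) (cong (_+ + d) (ℤP.pos-+ 1 i)) ⟩
      1ℤ + + i + + d      ≡⟨ reorder (+ i) (+ d) ⟩
      + i + + d + 1ℤ      ∎
      where
      reorder : ∀ x y → 1ℤ + x + y ≡ x + y + 1ℤ
      reorder = solve-∀
    identity : ∀ i d → + 2 * (i + d + 1ℤ + i + 1ℤ) - - (+ 2 * d + 1ℤ) ≡ 1ℤ * (+ 4 * (i + d + 1ℤ) + 1ℤ)
    identity = solve-∀
  A≡±O : + p ∣ₛ A - -1ℤ ^ k * O
  A≡±O = subst (λ x → + p ∣ₛ A - x)
    (trans (∏-neg (λ i → odds (k ℕ.∸ suc i)) k) (cong (-1ℤ ^ k *_) (∏-reverse odds k)))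
    (∏-cong-mod k upper≡-odd)
  2^[2k]EO≡EA : (+ 2) ^ (k ℕ.+ k) * (E * O) ≡ E * A
  2^[2k]EO≡EA = begin
    (+ 2) ^ (k ℕ.+ k) * (E * O)                           ≡⟨ cong ((+ 2) ^ (k ℕ.+ k) *_) (∏-succ-double k) ⟨
    (+ 2) ^ (k ℕ.+ k) * ∏ (λ i → + i + 1ℤ) (k ℕ.+ k)     ≡⟨ ∏-evens (k ℕ.+ k) ⟨
    ∏ evens (k ℕ.+ k)                                     ≡⟨ ∏-split evens k k ⟩
    E * A                                                 ∎
    where open ≡-Reasoning
  p∣[2k]!·[2^[2k]-[-1]^k] : + p ∣ₛ ∏ (λ i → + i + 1ℤ) (k ℕ.+ k) * ((+ 2) ^ (k ℕ.+ k) - -1ℤ ^ k)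
  p∣[2k]!·[2^[2k]-[-1]^k] = subst (+ p ∣ₛ_) (sym (begin
    ∏ (λ i → + i + 1ℤ) (k ℕ.+ k) * ((+ 2) ^ (k ℕ.+ k) - -1ℤ ^ k)
                                                              ≡⟨ cong (_* ((+ 2) ^ (k ℕ.+ k) - -1ℤ ^ k)) (∏-succ-double k) ⟩
    E * O * ((+ 2) ^ (k ℕ.+ k) - -1ℤ ^ k)                      ≡⟨ distribute E O ((+ 2) ^ (k ℕ.+ k)) (-1ℤ ^ k) ⟩
    (+ 2) ^ (k ℕ.+ k) * (E * O) - E * (-1ℤ ^ k * O)           ≡⟨ cong (_- E * (-1ℤ ^ k * O)) 2^[2k]EO≡EA ⟩
    E * A - E * (-1ℤ ^ k * O)                                 ≡⟨ factor E A (-1ℤ ^ k * O) ⟩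
    E * (A - -1ℤ ^ k * O)                                      ∎))
    (ℤD.∣n⇒∣m*n E A≡±O)
    where
    open ≡-Reasoning
    distribute : ∀ E O T s → E * O * (T - s) ≡ T * (E * O) - E * (s * O)
    distribute = solve-∀
    factor : ∀ E A B → E * A - E * B ≡ E * (A - B)
    factor = solve-∀

prime∤±2 : ∀ {p t} → Prime p → 2 ℕ.< p → t ≡ + 2 ⊎ t ≡ - + 2 → ¬ (+ p ∣ₛ t)
prime∤±2 pr 2<p (inj₁ refl) p∣2 = ℕP.<⇒≱ 2<p (∣2⇒≤2 p∣2)
prime∤±2 pr 2<p (inj₂ refl) p∣-2 = ℕP.<⇒≱ 2<p (∣2⇒≤2 (ℤD.∣m⇒∣-m p∣-2))

prime≡2h+1⇒>2 : ∀ {p} h → Prime p → p ≡ suc (h ℕ.+ h) → 2 ℕ.< p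
prime≡2h+1⇒>2 zero pr refl = ⊥-elim (ℕP.<-irrefl refl (prime>1 pr))
prime≡2h+1⇒>2 (suc h) pr refl = ℕ.s≤s (ℕ.s≤s (subst (1 ℕ.≤_) (sym (ℕP.+-suc h h)) (ℕ.s≤s ℕ.z≤n)))

-1-nonresidue : ∀ {p u v} h → Prime p → p ≡ suc (h ℕ.+ h) → -1ℤ ^ h ≡ -1ℤ →
                ¬ (+ p ∣ₛ v) → ¬ (+ p ∣ₛ u * u + v * v)
-1-nonresidue {p} {u} {v} h pr p≡2h+1 h-odd p∤v p∣u²+v² =
  ℕP.<⇒≱ (prime≡2h+1⇒>2 h pr p≡2h+1) (∣2⇒≤2 (ℤD.∣m⇒∣-m (subst (λ s → + p ∣ₛ s - 1ℤ) h-odd p∣[-1]^h-1)))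
  where
  p∣[-1]^h-1 : + p ∣ₛ -1ℤ ^ h - 1ℤ
  p∣[-1]^h-1 = euler-criterion {u = u} h pr p≡2h+1 (λ p∣-1 → prime∤1 pr (ℤD.∣m⇒∣-m p∣-1)) p∤v
    (subst (+ p ∣ₛ_) (identity u v) p∣u²+v²)
    where
    identity : ∀ u v → u * u + v * v ≡ u * u - -1ℤ * (v * v)
    identity = solve-∀

±2^[2k]≡2^[2k] : ∀ {t} k → t ≡ + 2 ⊎ t ≡ - + 2 → t ^ (k ℕ.+ k) ≡ (+ 2) ^ (k ℕ.+ k)
±2^[2k]≡2^[2k] k (inj₁ refl) = refl
±2^[2k]≡2^[2k] k (inj₂ refl) = trans (^-double (- + 2) k) (sym (^-double (+ 2) k))

±2-nonresidue : ∀ {p u v t} k → Prime p → p ≡ suc (k ℕ.+ k ℕ.+ (k ℕ.+ k)) → -1ℤ ^ k ≡ -1ℤ →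
                t ≡ + 2 ⊎ t ≡ - + 2 → ¬ (+ p ∣ₛ v) → ¬ (+ p ∣ₛ u * u - t * (v * v))
±2-nonresidue {p} {u} {v} {t} k pr p≡4k+1 k-odd t≡±2 p∤v p∣u²-tv² =
  ℕP.<⇒≱ 2<p (∣2⇒≤2 (∣-linear₂ p∣2^[2k]+1 p∣2^[2k]-1 1ℤ -1ℤ (identity ((+ 2) ^ (k ℕ.+ k)))))
  where
  2<p : 2 ℕ.< p
  2<p = prime≡2h+1⇒>2 (k ℕ.+ k) pr p≡4k+1
  p∣2^[2k]+1 : + p ∣ₛ (+ 2) ^ (k ℕ.+ k) - -1ℤ
  p∣2^[2k]+1 = subst (λ s → + p ∣ₛ (+ 2) ^ (k ℕ.+ k) - s) k-odd (prime∣2^[2k]-[-1]^k k pr p≡4k+1)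
  p∣2^[2k]-1 : + p ∣ₛ (+ 2) ^ (k ℕ.+ k) - 1ℤ
  p∣2^[2k]-1 = subst (λ s → + p ∣ₛ s - 1ℤ) (±2^[2k]≡2^[2k] k t≡±2)
    (euler-criterion {u = u} (k ℕ.+ k) pr p≡4k+1 (prime∤±2 pr 2<p t≡±2) p∤v p∣u²-tv²)
  identity : ∀ T → + 2 ≡ 1ℤ * (T - -1ℤ) + -1ℤ * (T - 1ℤ)
  identity = solve-∀

-- Local points

-- A Qₗ-point of C_{b1,b2} with denominator lᵉ gives x₁, x₂, x₃ with b1x₁² - b2x₂² = W and
-- b1x₁² - b1b2x₃² = -n²W, where W = l²ᵉ.  After dividing out common factors of l either e = 0, or
-- l² ∣ W and l does not divide all of x₁, x₂, x₃; all arguments only need the equations modulo l³.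
Solves : ℤ → ℕ → ℤ → ℤ → ℤ → ℤ → ℤ → ℤ → Set
Solves m n b1 b2 W x₁ x₂ x₃ =
  (m ∣ₛ b1 * x₁ * x₁ - b2 * x₂ * x₂ - W) × (m ∣ₛ b1 * x₁ * x₁ - b1 * b2 * x₃ * x₃ + + n * + n * W)

data LocalPoint (l n : ℕ) (b1 b2 : ℤ) : Set where
  integral : ∀ x₁ x₂ x₃ → Solves ((+ l) ^ 3) n b1 b2 1ℤ x₁ x₂ x₃ → LocalPoint l n b1 b2
  primitive-triple : ∀ W x₁ x₂ x₃ → + l * + l ∣ₛ W → Solves ((+ l) ^ 3) n b1 b2 W x₁ x₂ x₃ →
               ¬ (+ l ∣ₛ x₁ × + l ∣ₛ x₂ × + l ∣ₛ x₃) → LocalPoint l n b1 b2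

pow-∣-pow : ∀ a {j k} → j ℕ.≤ k → a ^ j ∣ₛ a ^ k
pow-∣-pow a {j} {k} j≤k = divides (a ^ (k ℕ.∸ j))
  (trans (cong (a ^_) (sym (ℕP.m+[n∸m]≡n j≤k)))
         (trans (ℤP.^-distribˡ-+-* a j (k ℕ.∸ j)) (ℤP.*-comm (a ^ j) (a ^ (k ℕ.∸ j)))))

module _ {l : ℕ} (pr : Prime l) where

  private
    L = + l
    instance
      _ = prime⇒nonZero pr

  ∣-cancel-l² : ∀ {k z} → L ^ suc (suc k) ∣ₛ L * (L * z) → L ^ k ∣ₛ z
  ∣-cancel-l² d = ℤD.*-cancelˡ-∣ L (ℤD.*-cancelˡ-∣ L d)

  descend : ∀ {n b1 b2} f x₁ x₂ x₃ →
            Solves (L ^ (f ℕ.+ f ℕ.+ 3)) n b1 b2 (L ^ (f ℕ.+ f)) x₁ x₂ x₃ → LocalPoint l n b1 b2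
  descend zero x₁ x₂ x₃ s = integral x₁ x₂ x₃ s
  descend {n} {b1} {b2} (suc f) x₁ x₂ x₃ (e₁ , e₂) with (l ∣?ₛ x₁) ×-dec (l ∣?ₛ x₂) ×-dec (l ∣?ₛ x₃)
  ... | no ¬l∣x = primitive-triple (L ^ (suc f ℕ.+ suc f)) x₁ x₂ x₃ l²∣W
        (ℤD.∣-trans (pow-∣-pow L 3≤K) e₁ , ℤD.∣-trans (pow-∣-pow L 3≤K) e₂) ¬l∣x
    where
    3≤K : 3 ℕ.≤ suc f ℕ.+ suc f ℕ.+ 3
    3≤K = ℕP.m≤n+m 3 (suc f ℕ.+ suc f)
    l²∣W : L * L ∣ₛ L ^ (suc f ℕ.+ suc f)
    l²∣W rewrite ℕP.+-suc f f = divides (L ^ (f ℕ.+ f)) (identity L (L ^ (f ℕ.+ f)))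
      where
      identity : ∀ L M → L * (L * M) ≡ M * (L * L)
      identity = solve-∀
  ... | yes (divides y₁ refl , divides y₂ refl , divides y₃ refl) =
    descend f y₁ y₂ y₃
      ( divide e₁ (trans (cong (λ w → b1 * (y₁ * L) * (y₁ * L) - b2 * (y₂ * L) * (y₂ * L) - w) W≡l²W′)
                         (identity₁ b1 b2 y₁ y₂ L (L ^ (f ℕ.+ f))))
      , divide e₂ (trans (cong (λ w → b1 * (y₁ * L) * (y₁ * L) - b1 * b2 * (y₃ * L) * (y₃ * L) + + n * + n * w)
                               W≡l²W′)
                         (identity₂ b1 b2 y₁ y₃ L (+ n) (L ^ (f ℕ.+ f)))))
    where
    W≡l²W′ : L ^ (suc f ℕ.+ suc f) ≡ L * (L * L ^ (f ℕ.+ f))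
    W≡l²W′ = cong (λ e → L ^ suc e) (ℕP.+-suc f f)
    divide : ∀ {A B} → L ^ (suc f ℕ.+ suc f ℕ.+ 3) ∣ₛ A → A ≡ L * (L * B) → L ^ (f ℕ.+ f ℕ.+ 3) ∣ₛ B
    divide d A≡l²B =
      ∣-cancel-l² {f ℕ.+ f ℕ.+ 3} (subst₂ _∣ₛ_ (cong (λ e → L ^ suc (e ℕ.+ 3)) (ℕP.+-suc f f)) A≡l²B d)
    identity₁ : ∀ b1 b2 y₁ y₂ L W → b1 * (y₁ * L) * (y₁ * L) - b2 * (y₂ * L) * (y₂ * L) - L * (L * W)
                                    ≡ L * (L * (b1 * y₁ * y₁ - b2 * y₂ * y₂ - W))
    identity₁ = solve-∀
    identity₂ : ∀ b1 b2 y₁ y₃ L N W → b1 * (y₁ * L) * (y₁ * L) - b1 * b2 * (y₃ * L) * (y₃ * L) + N * N * (L * (L * W))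
                                      ≡ L * (L * (b1 * y₁ * y₁ - b1 * b2 * y₃ * y₃ + N * N * W))
    identity₂ = solve-∀

  l³∣⇒l∣ : ∀ {z} → L ^ 3 ∣ₛ z → L ∣ₛ z
  l³∣⇒l∣ = ℤD.∣-trans (divides (L * (L * 1ℤ)) (ℤP.*-comm L (L * (L * 1ℤ))))

  l³∣⇒l²∣ : ∀ {z} → L ^ 3 ∣ₛ z → L * L ∣ₛ z
  l³∣⇒l²∣ = ℤD.∣-trans (divides L (identity L))
    where
    identity : ∀ L → L * (L * (L * 1ℤ)) ≡ L * (L * L)
    identity = solve-∀

  l²∣⇒l∣ : ∀ {z} → L * L ∣ₛ z → L ∣ₛ z
  l²∣⇒l∣ = ℤD.∣-trans (divides L refl)

  l²∣lz⇒l∣z : ∀ {z} → L * L ∣ₛ L * z → L ∣ₛ z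
  l²∣lz⇒l∣z = ℤD.*-cancelˡ-∣ L

  l³∣l²z⇒l∣z : ∀ {z} → L ^ 3 ∣ₛ L * (L * z) → L ∣ₛ z
  l³∣l²z⇒l∣z {z} d = subst (_∣ₛ z) (ℤP.*-identityʳ L) (∣-cancel-l² {1} d)

  prime∣a*x*x⇒∣x : ∀ {a x} → ¬ L ∣ₛ a → L ∣ₛ a * x * x → L ∣ₛ x
  prime∣a*x*x⇒∣x l∤a d with prime∣-* pr d
  ... | inj₂ l∣x = l∣x
  ... | inj₁ l∣ax = [ (λ l∣a → ⊥-elim (l∤a l∣a)) , (λ l∣x → l∣x) ]′ (prime∣-* pr l∣ax)

  prime∣a*b*x*x⇒∣x : ∀ {a b x} → ¬ L ∣ₛ a → ¬ L ∣ₛ b → L ∣ₛ a * b * x * x → L ∣ₛ x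
  prime∣a*b*x*x⇒∣x l∤a l∤b = prime∣a*x*x⇒∣x (λ l∣ab → [ l∤a , l∤b ]′ (prime∣-* pr l∣ab))

  exact-factor : ∀ {b} → L ∣ₛ b → ¬ (L * L ∣ₛ b) → Σ ℤ λ α → b ≡ α * L × ¬ L ∣ₛ α
  exact-factor {b} (divides α b≡αl) l²∤b = α , b≡αl , λ where
    (divides c refl) → l²∤b (divides c (trans b≡αl (ℤP.*-assoc c L L)))

  HasQlPoint⇒LocalPoint : ∀ {n b1 b2} → HasQlPoint n b1 b2 l → LocalPoint l n b1 b2
  HasQlPoint⇒LocalPoint (e , u₁ , u₂ , u₃ , solves) =
    descend e (seq u₁ k) (seq u₂ k) (seq u₃ k) (ℤD.∣ᵤ⇒∣ (proj₁ (solves k)) , ℤD.∣ᵤ⇒∣ (proj₂ (solves k)))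
    where k = e ℕ.+ e ℕ.+ 3

  b1-exact⇒l∣triple : ∀ {n α b2 W x₁ x₂ x₃} → ¬ L ∣ₛ α → ¬ L ∣ₛ b2 → L * L ∣ₛ W →
                      Solves (L ^ 3) n (α * L) b2 W x₁ x₂ x₃ → L ∣ₛ x₁ × L ∣ₛ x₂ × L ∣ₛ x₃
  b1-exact⇒l∣triple {n} {α} {b2} {W} {x₁} {x₂} {x₃} l∤α l∤b2 l²∣W (e₁ , e₂) = from-x₂ l∣x₂
    where
    l∣x₂ : L ∣ₛ x₂
    l∣x₂ = prime∣a*x*x⇒∣x l∤b2 (∣-linear₃ (l³∣⇒l∣ e₁) (l²∣⇒l∣ l²∣W) (∣-self (α * x₁ * x₁)) -1ℤ -1ℤ 1ℤ
      (identity α L x₁ b2 x₂ W))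
      where
      identity : ∀ α L x₁ b2 x₂ W → b2 * x₂ * x₂ ≡ -1ℤ * (α * L * x₁ * x₁ - b2 * x₂ * x₂ - W) + -1ℤ * W + 1ℤ * (α * x₁ * x₁ * L)
      identity = solve-∀
    from-x₂ : L ∣ₛ x₂ → L ∣ₛ x₁ × L ∣ₛ x₂ × L ∣ₛ x₃
    from-x₂ (divides y₂ refl) = from-x₁ l∣x₁
      where
      l∣x₁ : L ∣ₛ x₁
      l∣x₁ = prime∣a*x*x⇒∣x l∤α (l²∣lz⇒l∣z (∣-linear₃ (l³∣⇒l²∣ e₁) (∣-self (b2 * y₂ * y₂)) l²∣W 1ℤ 1ℤ 1ℤ
        (identity α L x₁ b2 y₂ W)))
        where
        identity : ∀ α L x₁ b2 y₂ W → L * (α * x₁ * x₁)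
          ≡ 1ℤ * (α * L * x₁ * x₁ - b2 * (y₂ * L) * (y₂ * L) - W) + 1ℤ * (b2 * y₂ * y₂ * (L * L)) + 1ℤ * W
        identity = solve-∀
      from-x₁ : L ∣ₛ x₁ → L ∣ₛ x₁ × L ∣ₛ y₂ * L × L ∣ₛ x₃
      from-x₁ (divides y₁ refl) = divides y₁ refl , divides y₂ refl , l∣x₃
        where
        l∣x₃ : L ∣ₛ x₃
        l∣x₃ = prime∣a*b*x*x⇒∣x l∤α l∤b2 (l²∣lz⇒l∣z (∣-linear₃ (l³∣⇒l²∣ e₂) (∣-self (α * y₁ * y₁ * L))
          (ℤD.∣n⇒∣m*n (+ n * + n) l²∣W) -1ℤ 1ℤ 1ℤ (identity α L y₁ b2 x₃ (+ n) W)))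
          where
          identity : ∀ α L y₁ b2 x₃ N W → L * (α * b2 * x₃ * x₃)
            ≡ -1ℤ * (α * L * (y₁ * L) * (y₁ * L) - α * L * b2 * x₃ * x₃ + N * N * W)
              + 1ℤ * (α * y₁ * y₁ * L * (L * L)) + 1ℤ * (N * N * W)
          identity = solve-∀

  b1-exact⇒no-point : ∀ {n α b2} → ¬ L ∣ₛ + n → ¬ L ∣ₛ α → ¬ L ∣ₛ b2 → ¬ LocalPoint l n (α * L) b2
  b1-exact⇒no-point {n} {α} {b2} l∤n l∤α l∤b2 (integral x₁ x₂ x₃ (_ , e₂)) =
    l∤n (prime∣-square pr (∣-linear₃ (l³∣⇒l∣ e₂) (∣-self (α * x₁ * x₁)) (∣-self (α * b2 * x₃ * x₃)) 1ℤ -1ℤ 1ℤ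
      (identity α L b2 x₁ x₃ (+ n))))
    where
    identity : ∀ α L b2 x₁ x₃ N → N * N
      ≡ 1ℤ * (α * L * x₁ * x₁ - α * L * b2 * x₃ * x₃ + N * N * 1ℤ) + -1ℤ * (α * x₁ * x₁ * L) + 1ℤ * (α * b2 * x₃ * x₃ * L)
    identity = solve-∀
  b1-exact⇒no-point {n} l∤n l∤α l∤b2 (primitive-triple W x₁ x₂ x₃ l²∣W s l∤triple) =
    l∤triple (b1-exact⇒l∣triple {n} l∤α l∤b2 l²∣W s)

  b2-exact⇒no-point : ∀ {n b1 β} → L ∣ₛ + n → ¬ L ∣ₛ β → ¬ (L * L ∣ₛ b1) → ¬ LocalPoint l n b1 (β * L)
  b2-exact⇒no-point {n} {b1} {β} l∣n l∤β l²∤b1 (integral x₁ x₂ x₃ (e₁ , e₂)) =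
    prime∤1 pr (∣-linear₄ (l³∣⇒l∣ e₂) (l³∣⇒l∣ e₁) (∣-self (β * (b1 * x₃ * x₃ - x₂ * x₂))) l∣n 1ℤ -1ℤ 1ℤ (- + n)
      (identity b1 β L x₁ x₂ x₃ (+ n)))
    where
    identity : ∀ b1 β L x₁ x₂ x₃ N → 1ℤ
      ≡ 1ℤ * (b1 * x₁ * x₁ - b1 * (β * L) * x₃ * x₃ + N * N * 1ℤ) + -1ℤ * (b1 * x₁ * x₁ - β * L * x₂ * x₂ - 1ℤ)
        + 1ℤ * (β * (b1 * x₃ * x₃ - x₂ * x₂) * L) + (- N) * N
    identity = solve-∀
  b2-exact⇒no-point {n} {b1} {β} l∣n l∤β l²∤b1 (primitive-triple W x₁ x₂ x₃ l²∣W (e₁ , e₂) l∤triple)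
    with l ∣?ₛ b1
  ... | no l∤b1 = l∤triple (from-x₁ l∣x₁)
    where
    l∣x₁ : L ∣ₛ x₁
    l∣x₁ = prime∣a*x*x⇒∣x l∤b1 (∣-linear₃ (l³∣⇒l∣ e₁) (∣-self (β * x₂ * x₂)) (l²∣⇒l∣ l²∣W) 1ℤ 1ℤ 1ℤ
      (identity b1 β L x₁ x₂ W))
      where
      identity : ∀ b1 β L x₁ x₂ W → b1 * x₁ * x₁ ≡ 1ℤ * (b1 * x₁ * x₁ - β * L * x₂ * x₂ - W) + 1ℤ * (β * x₂ * x₂ * L) + 1ℤ * W
      identity = solve-∀
    from-x₁ : L ∣ₛ x₁ → L ∣ₛ x₁ × L ∣ₛ x₂ × L ∣ₛ x₃
    from-x₁ (divides y₁ refl) = divides y₁ refl , l∣x₂ , l∣x₃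
      where
      l∣x₂ : L ∣ₛ x₂
      l∣x₂ = prime∣a*x*x⇒∣x l∤β (l²∣lz⇒l∣z (∣-linear₃ (l³∣⇒l²∣ e₁) (∣-self (b1 * y₁ * y₁)) l²∣W -1ℤ 1ℤ -1ℤ
        (identity b1 β L y₁ x₂ W)))
        where
        identity : ∀ b1 β L y₁ x₂ W → L * (β * x₂ * x₂)
          ≡ -1ℤ * (b1 * (y₁ * L) * (y₁ * L) - β * L * x₂ * x₂ - W) + 1ℤ * (b1 * y₁ * y₁ * (L * L)) + -1ℤ * W
        identity = solve-∀
      l∣x₃ : L ∣ₛ x₃
      l∣x₃ = prime∣a*b*x*x⇒∣x l∤b1 l∤β (l²∣lz⇒l∣z (∣-linear₃ (l³∣⇒l²∣ e₂) (∣-self (b1 * y₁ * y₁))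
        (ℤD.∣n⇒∣m*n (+ n * + n) l²∣W) -1ℤ 1ℤ 1ℤ (identity b1 β L y₁ x₃ (+ n) W)))
        where
        identity : ∀ b1 β L y₁ x₃ N W → L * (b1 * β * x₃ * x₃)
          ≡ -1ℤ * (b1 * (y₁ * L) * (y₁ * L) - b1 * (β * L) * x₃ * x₃ + N * N * W)
            + 1ℤ * (b1 * y₁ * y₁ * (L * L)) + 1ℤ * (N * N * W)
        identity = solve-∀
  ... | yes l∣b1 with exact-factor l∣b1 l²∤b1
  ... | α , refl , l∤α = l∤triple (from-x₁ l∣x₁)
    where
    l∣x₁ : L ∣ₛ x₁
    l∣x₁ = prime∣a*x*x⇒∣x l∤α (l²∣lz⇒l∣z (∣-linear₃ (l³∣⇒l²∣ e₂) (∣-self (α * β * x₃ * x₃))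
      (ℤD.∣n⇒∣m*n (+ n * + n) l²∣W) 1ℤ 1ℤ -1ℤ (identity α β L x₁ x₃ (+ n) W)))
      where
      identity : ∀ α β L x₁ x₃ N W → L * (α * x₁ * x₁)
        ≡ 1ℤ * (α * L * x₁ * x₁ - α * L * (β * L) * x₃ * x₃ + N * N * W)
          + 1ℤ * (α * β * x₃ * x₃ * (L * L)) + -1ℤ * (N * N * W)
      identity = solve-∀
    from-x₁ : L ∣ₛ x₁ → L ∣ₛ x₁ × L ∣ₛ x₂ × L ∣ₛ x₃
    from-x₁ (divides y₁ refl) = divides y₁ refl , l∣x₂ , l∣x₃
      where
      l∣x₂ : L ∣ₛ x₂
      l∣x₂ = prime∣a*x*x⇒∣x l∤β (l²∣lz⇒l∣z (∣-linear₃ (l³∣⇒l²∣ e₁) (∣-self (α * y₁ * y₁ * L)) l²∣W -1ℤ 1ℤ -1ℤ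
        (identity α β L y₁ x₂ W)))
        where
        identity : ∀ α β L y₁ x₂ W → L * (β * x₂ * x₂)
          ≡ -1ℤ * (α * L * (y₁ * L) * (y₁ * L) - β * L * x₂ * x₂ - W) + 1ℤ * (α * y₁ * y₁ * L * (L * L)) + -1ℤ * W
        identity = solve-∀
      l³∣n²W : L ^ 3 ∣ₛ + n * (+ n * W)
      l³∣n²W = ℤD.∣n⇒∣m*n (+ n) (subst (_∣ₛ + n * W) (identity L)
        (ℤD.∣-trans (ℤD.*-monoˡ-∣ (L * L) l∣n) (ℤD.*-monoʳ-∣ (+ n) l²∣W)))
        where
        identity : ∀ L → L * (L * L) ≡ L * (L * (L * 1ℤ))
        identity = solve-∀
      l∣x₃ : L ∣ₛ x₃
      l∣x₃ = prime∣a*b*x*x⇒∣x l∤α l∤β (l³∣l²z⇒l∣z (∣-linear₃ e₂ (∣-self (α * y₁ * y₁)) l³∣n²W -1ℤ 1ℤ 1ℤ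
        (identity α β L y₁ x₃ (+ n) W)))
        where
        identity : ∀ α β L y₁ x₃ N W → L * (L * (α * β * x₃ * x₃))
          ≡ -1ℤ * (α * L * (y₁ * L) * (y₁ * L) - α * L * (β * L) * x₃ * x₃ + N * N * W)
            + 1ℤ * (α * y₁ * y₁ * (L * (L * (L * 1ℤ)))) + 1ℤ * (N * (N * W))
        identity = solve-∀

  QuadraticResidue : ℤ → Set
  QuadraticResidue t = Σ ℤ λ u → Σ ℤ λ v → ¬ L ∣ₛ v × L ∣ₛ u * u - t * (v * v)

  b1-exact⇒-1-residue : ∀ {n α b2} → L ∣ₛ + n → ¬ (L * L ∣ₛ + n) → ¬ L ∣ₛ α → ¬ L ∣ₛ b2 →
                        LocalPoint l n (α * L) b2 → QuadraticResidue -1ℤ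
  b1-exact⇒-1-residue {n} l∣n l²∤n l∤α l∤b2 (primitive-triple W x₁ x₂ x₃ l²∣W s l∤triple) =
    ⊥-elim (l∤triple (b1-exact⇒l∣triple {n} l∤α l∤b2 l²∣W s))
  b1-exact⇒-1-residue {n} {α} {b2} l∣n l²∤n l∤α l∤b2 (integral x₁ x₂ x₃ (e₁ , e₂)) = residue (l ∣?ₛ x₃)
    where
    N = + n
    b2x₂²≡-1 : L ∣ₛ b2 * x₂ * x₂ + 1ℤ
    b2x₂²≡-1 = ∣-linear₂ (l³∣⇒l∣ e₁) (∣-self (α * x₁ * x₁)) -1ℤ 1ℤ (identity α L x₁ b2 x₂)
      where
      identity : ∀ α L x₁ b2 x₂ → b2 * x₂ * x₂ + 1ℤ ≡ -1ℤ * (α * L * x₁ * x₁ - b2 * x₂ * x₂ - 1ℤ) + 1ℤ * (α * x₁ * x₁ * L)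
      identity = solve-∀
    x₁²≡b2x₃² : L ∣ₛ x₁ * x₁ - b2 * x₃ * x₃
    x₁²≡b2x₃² = [ (λ l∣α → ⊥-elim (l∤α l∣α)) , (λ d → d) ]′ (prime∣-* pr (l²∣lz⇒l∣z
      (∣-linear₂ (l³∣⇒l²∣ e₂) (ℤD.∣-trans (ℤD.*-monoˡ-∣ L l∣n) (ℤD.*-monoʳ-∣ N l∣n)) 1ℤ -1ℤ (identity α L x₁ b2 x₃ N))))
      where
      identity : ∀ α L x₁ b2 x₃ N → L * (α * (x₁ * x₁ - b2 * x₃ * x₃))
        ≡ 1ℤ * (α * L * x₁ * x₁ - α * L * b2 * x₃ * x₃ + N * N * 1ℤ) + -1ℤ * (N * N)
      identity = solve-∀
    residue : Dec (L ∣ₛ x₃) → QuadraticResidue -1ℤ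
    residue (no l∤x₃) = x₁ * x₂ , x₃ , l∤x₃ ,
      ∣-linear₂ b2x₂²≡-1 x₁²≡b2x₃² (x₃ * x₃) (x₂ * x₂) (identity x₁ x₂ x₃ b2)
      where
      identity : ∀ x₁ x₂ x₃ b2 → x₁ * x₂ * (x₁ * x₂) - -1ℤ * (x₃ * x₃)
        ≡ x₃ * x₃ * (b2 * x₂ * x₂ + 1ℤ) + x₂ * x₂ * (x₁ * x₁ - b2 * x₃ * x₃)
      identity = solve-∀
    residue (yes (divides y₃ refl)) = ⊥-elim (l²∤n (l∣x₁⇒l²∣n l∣x₁))
      where
      l∣x₁ : L ∣ₛ x₁
      l∣x₁ = prime∣-square pr (∣-linear₂ x₁²≡b2x₃² (∣-self (b2 * y₃ * y₃ * L)) 1ℤ 1ℤ (identity x₁ b2 y₃ L))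
        where
        identity : ∀ x₁ b2 y₃ L → x₁ * x₁ ≡ 1ℤ * (x₁ * x₁ - b2 * (y₃ * L) * (y₃ * L)) + 1ℤ * (b2 * y₃ * y₃ * L * L)
        identity = solve-∀
      l∣x₁⇒l²∣n : L ∣ₛ x₁ → L * L ∣ₛ N
      l∣x₁⇒l²∣n (divides y₁ refl) = subst (L * L ∣ₛ_) (sym n≡νL) (ℤD.*-monoˡ-∣ L (prime∣-square {a = ν} pr (l³∣l²z⇒l∣z
        (∣-linear₃ e₂′ (∣-self (α * y₁ * y₁)) (∣-self (α * b2 * y₃ * y₃)) 1ℤ -1ℤ 1ℤ (identity α L b2 y₁ y₃ ν)))))
        where
        ν = ℤD._∣_.quotient l∣n
        n≡νL = ℤD._∣_.equality l∣n
        e₂′ : L ^ 3 ∣ₛ α * L * (y₁ * L) * (y₁ * L) - α * L * b2 * (y₃ * L) * (y₃ * L) + ν * L * (ν * L) * 1ℤ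
        e₂′ = subst (λ m → L ^ 3 ∣ₛ α * L * (y₁ * L) * (y₁ * L) - α * L * b2 * (y₃ * L) * (y₃ * L) + m * m * 1ℤ) n≡νL e₂
        identity : ∀ α L b2 y₁ y₃ ν → L * (L * (ν * ν))
          ≡ 1ℤ * (α * L * (y₁ * L) * (y₁ * L) - α * L * b2 * (y₃ * L) * (y₃ * L) + ν * L * (ν * L) * 1ℤ)
            + -1ℤ * (α * y₁ * y₁ * (L * (L * (L * 1ℤ)))) + 1ℤ * (α * b2 * y₃ * y₃ * (L * (L * (L * 1ℤ))))
        identity = solve-∀

  point-on-C[1,q]⇒±2-residue : ∀ {n q} → L ∣ₛ + n → + 2 * q ≡ + n * + n + 1ℤ → LocalPoint l n 1ℤ q →
                               Σ ℤ λ t → (t ≡ + 2 ⊎ t ≡ - + 2) × QuadraticResidue t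
  point-on-C[1,q]⇒±2-residue {n} {q} l∣n 2q≡n²+1 (integral x₁ x₂ x₃ (e₁ , e₂)) = residue (l ∣?ₛ x₁)
    where
    N = + n
    residue : Dec (L ∣ₛ x₁) → Σ ℤ λ t → (t ≡ + 2 ⊎ t ≡ - + 2) × QuadraticResidue t
    residue (no l∤x₁) = + 2 , inj₁ refl , x₃ , x₁ , l∤x₁ ,
      ∣-linear₃ (l³∣⇒l∣ e₂) (≡⇒∣- 2q≡n²+1) l∣n (- + 2) (- (x₃ * x₃)) (- (N * x₃ * x₃ - + 2 * N)) (identity q x₁ x₃ N)
      where
      identity : ∀ q x₁ x₃ N → x₃ * x₃ - + 2 * (x₁ * x₁)
        ≡ - + 2 * (1ℤ * x₁ * x₁ - 1ℤ * q * x₃ * x₃ + N * N * 1ℤ) + - (x₃ * x₃) * (+ 2 * q - (N * N + 1ℤ))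
          + - (N * x₃ * x₃ - + 2 * N) * N
      identity = solve-∀
    residue (yes (divides y₁ refl)) = - + 2 , inj₂ refl , x₂ , 1ℤ , prime∤1 pr ,
      ∣-linear₄ (l³∣⇒l∣ e₁) (∣-self (+ 2 * y₁ * y₁ * L)) (≡⇒∣- 2q≡n²+1) l∣n (- + 2) 1ℤ (- (x₂ * x₂)) (- (N * x₂ * x₂))
        (identity q y₁ x₂ N L)
      where
      identity : ∀ q y₁ x₂ N L → x₂ * x₂ - - + 2 * (1ℤ * 1ℤ)
        ≡ - + 2 * (1ℤ * (y₁ * L) * (y₁ * L) - q * x₂ * x₂ - 1ℤ) + 1ℤ * (+ 2 * y₁ * y₁ * L * L)
          + - (x₂ * x₂) * (+ 2 * q - (N * N + 1ℤ)) + - (N * x₂ * x₂) * N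
      identity = solve-∀
  point-on-C[1,q]⇒±2-residue {n} {q} l∣n 2q≡n²+1 (primitive-triple W x₁ x₂ x₃ l²∣W (e₁ , e₂) l∤triple) =
    residue (l ∣?ₛ x₁)
    where
    N = + n
    x₂²≡2x₁² : L ∣ₛ x₂ * x₂ - + 2 * (x₁ * x₁)
    x₂²≡2x₁² = ∣-linear₄ (l³∣⇒l∣ e₁) (≡⇒∣- 2q≡n²+1) l∣n (l²∣⇒l∣ l²∣W) (- + 2) (- (x₂ * x₂)) (- (N * x₂ * x₂)) (- + 2)
      (identity q x₁ x₂ N W)
      where
      identity : ∀ q x₁ x₂ N W → x₂ * x₂ - + 2 * (x₁ * x₁)
        ≡ - + 2 * (1ℤ * x₁ * x₁ - q * x₂ * x₂ - W) + - (x₂ * x₂) * (+ 2 * q - (N * N + 1ℤ))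
          + - (N * x₂ * x₂) * N + - + 2 * W
      identity = solve-∀
    x₃²≡2x₁² : L ∣ₛ x₃ * x₃ - + 2 * (x₁ * x₁)
    x₃²≡2x₁² = ∣-linear₄ (l³∣⇒l∣ e₂) (≡⇒∣- 2q≡n²+1) l∣n (l²∣⇒l∣ l²∣W) (- + 2) (- (x₃ * x₃)) (- (N * x₃ * x₃)) (+ 2 * N * N)
      (identity q x₁ x₃ N W)
      where
      identity : ∀ q x₁ x₃ N W → x₃ * x₃ - + 2 * (x₁ * x₁)
        ≡ - + 2 * (1ℤ * x₁ * x₁ - 1ℤ * q * x₃ * x₃ + N * N * W) + - (x₃ * x₃) * (+ 2 * q - (N * N + 1ℤ))
          + - (N * x₃ * x₃) * N + + 2 * N * N * W
      identity = solve-∀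
    residue : Dec (L ∣ₛ x₁) → Σ ℤ λ t → (t ≡ + 2 ⊎ t ≡ - + 2) × QuadraticResidue t
    residue (no l∤x₁) = + 2 , inj₁ refl , x₂ , x₁ , l∤x₁ , x₂²≡2x₁²
    residue (yes (divides y₁ refl)) =
      ⊥-elim (l∤triple (divides y₁ refl , square-root x₂²≡2x₁² , square-root x₃²≡2x₁²))
      where
      square-root : ∀ {x} → L ∣ₛ x * x - + 2 * (y₁ * L * (y₁ * L)) → L ∣ₛ x
      square-root {x} d = prime∣-square pr (∣-linear₂ d (∣-self (+ 2 * y₁ * y₁ * L)) 1ℤ 1ℤ (identity x y₁ L))
        where
        identity : ∀ x y₁ L → x * x ≡ 1ℤ * (x * x - + 2 * (y₁ * L * (y₁ * L))) + 1ℤ * (+ 2 * y₁ * y₁ * L * L)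
        identity = solve-∀

-- The prime 2

2∣x⊎2∣x-1 : ∀ x → + 2 ∣ₛ x ⊎ + 2 ∣ₛ x - 1ℤ
2∣x⊎2∣x-1 x = by-remainder (x ℤ.%ℕ 2) (ℤDM.n%ℕd<d x 2) (ℤDM.a≡a%ℕn+[a/ℕn]*n x 2)
  where
  by-remainder : ∀ r → r ℕ.< 2 → x ≡ + r + x ℤ./ℕ 2 * + 2 → + 2 ∣ₛ x ⊎ + 2 ∣ₛ x - 1ℤ
  by-remainder 0 _ x≡2k = inj₁ (divides (x ℤ./ℕ 2) (trans x≡2k (ℤP.+-identityˡ _)))
  by-remainder 1 _ x≡2k+1 = inj₂ (divides (x ℤ./ℕ 2) (trans (cong (_- 1ℤ) x≡2k+1) (cancel (x ℤ./ℕ 2))))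
    where
    cancel : ∀ k → 1ℤ + k * + 2 - 1ℤ ≡ k * + 2
    cancel = solve-∀
  by-remainder (suc (suc _)) (ℕ.s≤s (ℕ.s≤s ())) _

odd⇒2∣x-1 : ∀ {x} → ¬ (+ 2 ∣ₛ x) → + 2 ∣ₛ x - 1ℤ
odd⇒2∣x-1 {x} 2∤x = [ (λ 2∣x → ⊥-elim (2∤x 2∣x)) , (λ 2∣x-1 → 2∣x-1) ]′ (2∣x⊎2∣x-1 x)

odd²≡1[8] : ∀ {x} → ¬ (+ 2 ∣ₛ x) → + 8 ∣ₛ x * x - 1ℤ
odd²≡1[8] {x} 2∤x with odd⇒2∣x-1 2∤x
... | divides y x-1≡2y = [ even , odd ]′ (2∣x⊎2∣x-1 y)
  where
  x≡2y+1 : x ≡ y * + 2 + 1ℤ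
  x≡2y+1 = trans (sym (shift x)) (cong (_+ 1ℤ) x-1≡2y)
    where
    shift : ∀ x → x - 1ℤ + 1ℤ ≡ x
    shift = solve-∀
  even : + 2 ∣ₛ y → + 8 ∣ₛ x * x - 1ℤ
  even (divides z refl) = divides (z * z * + 2 + z) (trans (cong (λ w → w * w - 1ℤ) x≡2y+1) (identity z))
    where
    identity : ∀ z → (z * + 2 * + 2 + 1ℤ) * (z * + 2 * + 2 + 1ℤ) - 1ℤ ≡ (z * z * + 2 + z) * + 8
    identity = solve-∀
  odd : + 2 ∣ₛ y - 1ℤ → + 8 ∣ₛ x * x - 1ℤ
  odd (divides z y-1≡2z) = divides (z * z * + 2 + + 3 * z + 1ℤ)
    (trans (cong (λ w → w * w - 1ℤ) (trans x≡2y+1 (cong (λ w → w * + 2 + 1ℤ) y≡2z+1))) (identity z))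
    where
    y≡2z+1 : y ≡ z * + 2 + 1ℤ
    y≡2z+1 = trans (sym (shift y)) (cong (_+ 1ℤ) y-1≡2z)
      where
      shift : ∀ x → x - 1ℤ + 1ℤ ≡ x
      shift = solve-∀
    identity : ∀ z → ((z * + 2 + 1ℤ) * + 2 + 1ℤ) * ((z * + 2 + 1ℤ) * + 2 + 1ℤ) - 1ℤ ≡ (z * z * + 2 + + 3 * z + 1ℤ) * + 8
    identity = solve-∀

4∤2 : ¬ (+ 4 ∣ₛ + 2)
4∤2 d with ℕD.∣⇒≤ (ℤD.∣⇒∣ᵤ d)
... | ℕ.s≤s (ℕ.s≤s ())

8∣⇒4∣ : ∀ {z} → + 8 ∣ₛ z → + 4 ∣ₛ z
8∣⇒4∣ = ℤD.∣-trans (divides (+ 2) refl)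

4∣⇒2∣ : ∀ {z} → + 4 ∣ₛ z → + 2 ∣ₛ z
4∣⇒2∣ = ℤD.∣-trans (divides (+ 2) refl)

8∣⇒2∣ : ∀ {z} → + 8 ∣ₛ z → + 2 ∣ₛ z
8∣⇒2∣ d = 4∣⇒2∣ (8∣⇒4∣ d)

4∣b-1⇒odd : ∀ {b} → + 4 ∣ₛ b - 1ℤ → ¬ (+ 2 ∣ₛ b)
4∣b-1⇒odd {b} 4∣b-1 2∣b = prime∤1 prime[2] (∣-linear₂ 2∣b (4∣⇒2∣ 4∣b-1) 1ℤ -1ℤ (identity b))
  where
  identity : ∀ b → 1ℤ ≡ 1ℤ * b + -1ℤ * (b - 1ℤ)
  identity = solve-∀

2∣x⇒4∣x² : ∀ {x} → + 2 ∣ₛ x → + 4 ∣ₛ x * x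
2∣x⇒4∣x² {x} 2∣x = ℤD.∣-trans (ℤD.*-monoˡ-∣ (+ 2) 2∣x) (ℤD.*-monoʳ-∣ x 2∣x)

odd*odd²≡1[2] : ∀ {a x} → ¬ (+ 2 ∣ₛ a) → ¬ (+ 2 ∣ₛ x) → + 2 ∣ₛ a * x * x - 1ℤ
odd*odd²≡1[2] 2∤a 2∤x = odd⇒2∣x-1 (λ 2∣ax² → 2∤x (prime∣a*x*x⇒∣x prime[2] 2∤a 2∣ax²))

integral-at-2-odd-x₁⇒even : ∀ n b1 b2 x₁ x₂ x₃ → ¬ (+ 2 ∣ₛ + n) → ¬ (+ 2 ∣ₛ b1) → ¬ (+ 2 ∣ₛ b2) →
                            ¬ (+ 2 ∣ₛ x₁) → Solves (+ 8) n b1 b2 1ℤ x₁ x₂ x₃ → + 2 ∣ₛ x₂ × + 2 ∣ₛ x₃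
integral-at-2-odd-x₁⇒even n b1 b2 x₁ x₂ x₃ 2∤n 2∤b1 2∤b2 2∤x₁ (e₁ , e₂) =
  prime∣a*x*x⇒∣x prime[2] 2∤b2 (∣-linear₂ (8∣⇒2∣ e₁) 2∣b1x₁²-1 -1ℤ 1ℤ (identity₂ b1 b2 x₁ x₂)) ,
  prime∣a*b*x*x⇒∣x prime[2] 2∤b1 2∤b2 (∣-linear₄ (8∣⇒2∣ e₂) 2∣b1x₁²-1 (8∣⇒2∣ (odd²≡1[8] 2∤n)) (∣-self 1ℤ)
    -1ℤ 1ℤ 1ℤ 1ℤ (identity₃ b1 b2 x₁ x₃ (+ n)))
  where
  2∣b1x₁²-1 = odd*odd²≡1[2] 2∤b1 2∤x₁
  identity₂ : ∀ b1 b2 x₁ x₂ → b2 * x₂ * x₂ ≡ -1ℤ * (b1 * x₁ * x₁ - b2 * x₂ * x₂ - 1ℤ) + 1ℤ * (b1 * x₁ * x₁ - 1ℤ)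
  identity₂ = solve-∀
  identity₃ : ∀ b1 b2 x₁ x₃ N → b1 * b2 * x₃ * x₃
    ≡ -1ℤ * (b1 * x₁ * x₁ - b1 * b2 * x₃ * x₃ + N * N * 1ℤ) + 1ℤ * (b1 * x₁ * x₁ - 1ℤ) + 1ℤ * (N * N - 1ℤ) + 1ℤ * (1ℤ * + 2)
  identity₃ = solve-∀

integral-at-2-even-x₂x₃ : ∀ n b1 b2 x₁ x₂ x₃ → ¬ (+ 2 ∣ₛ + n) → Solves (+ 8) n b1 b2 1ℤ x₁ x₂ x₃ →
                          + 2 ∣ₛ x₂ → ¬ (+ 2 ∣ₛ x₃)
integral-at-2-even-x₂x₃ n b1 b2 x₁ x₂ x₃ 2∤n (e₁ , e₂) 2∣x₂ 2∣x₃ =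
  4∤2 (∣-linear₄ (8∣⇒4∣ e₂) (8∣⇒4∣ e₁) (8∣⇒4∣ (odd²≡1[8] 2∤n)) 4∣b1b2x₃²-b2x₂² 1ℤ -1ℤ -1ℤ 1ℤ
    (identity b1 b2 x₁ x₂ x₃ (+ n)))
  where
  4∣b1b2x₃²-b2x₂² : + 4 ∣ₛ b1 * b2 * (x₃ * x₃) - b2 * (x₂ * x₂)
  4∣b1b2x₃²-b2x₂² = ℤD.∣m∣n⇒∣m-n (ℤD.∣n⇒∣m*n (b1 * b2) (2∣x⇒4∣x² 2∣x₃)) (ℤD.∣n⇒∣m*n b2 (2∣x⇒4∣x² 2∣x₂))
  identity : ∀ b1 b2 x₁ x₂ x₃ N → + 2
    ≡ 1ℤ * (b1 * x₁ * x₁ - b1 * b2 * x₃ * x₃ + N * N * 1ℤ) + -1ℤ * (b1 * x₁ * x₁ - b2 * x₂ * x₂ - 1ℤ)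
      + -1ℤ * (N * N - 1ℤ) + 1ℤ * (b1 * b2 * (x₃ * x₃) - b2 * (x₂ * x₂))
  identity = solve-∀

integral-at-2-even-x₁-even-x₂ : ∀ b1 b2 x₁ x₂ → + 8 ∣ₛ b1 * x₁ * x₁ - b2 * x₂ * x₂ - 1ℤ →
                                + 4 ∣ₛ x₁ * x₁ → ¬ (+ 2 ∣ₛ x₂)
integral-at-2-even-x₁-even-x₂ b1 b2 x₁ x₂ e₁ 4∣x₁² 2∣x₂ = prime∤1 prime[2]
  (∣-linear₃ (8∣⇒2∣ e₁) (4∣⇒2∣ 4∣x₁²) (4∣⇒2∣ (2∣x⇒4∣x² 2∣x₂)) -1ℤ b1 (- b2) (identity b1 b2 x₁ x₂))
  where
  identity : ∀ b1 b2 x₁ x₂ → 1ℤ ≡ -1ℤ * (b1 * x₁ * x₁ - b2 * x₂ * x₂ - 1ℤ) + b1 * (x₁ * x₁) + - b2 * (x₂ * x₂)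
  identity = solve-∀

integral-at-2-even-x₁-odd-x₂ : ∀ b1 b2 x₁ x₂ → + 4 ∣ₛ b2 - 1ℤ → + 8 ∣ₛ b1 * x₁ * x₁ - b2 * x₂ * x₂ - 1ℤ →
                               + 4 ∣ₛ x₁ * x₁ → ¬ ¬ (+ 2 ∣ₛ x₂)
integral-at-2-even-x₁-odd-x₂ b1 b2 x₁ x₂ 4∣b2-1 e₁ 4∣x₁² 2∤x₂ =
  4∤2 (∣-linear₄ (8∣⇒4∣ e₁) 4∣x₁² (8∣⇒4∣ (odd²≡1[8] 2∤x₂)) 4∣b2-1 -1ℤ b1 (- b2) -1ℤ (identity b1 b2 x₁ x₂))
  where
  identity : ∀ b1 b2 x₁ x₂ → + 2
    ≡ -1ℤ * (b1 * x₁ * x₁ - b2 * x₂ * x₂ - 1ℤ) + b1 * (x₁ * x₁) + - b2 * (x₂ * x₂ - 1ℤ) + -1ℤ * (b2 - 1ℤ)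
  identity = solve-∀

no-integral-point-at-2 : ∀ n b1 b2 x₁ x₂ x₃ → ¬ (+ 2 ∣ₛ + n) → ¬ (+ 2 ∣ₛ b1) → + 4 ∣ₛ b2 - 1ℤ →
                         ¬ Solves (+ 8) n b1 b2 1ℤ x₁ x₂ x₃
no-integral-point-at-2 n b1 b2 x₁ x₂ x₃ 2∤n 2∤b1 4∣b2-1 s@(e₁ , _) =
  [ x₁-even , x₁-odd ]′ (toSum (2 ∣?ₛ x₁))
  where
  x₁-even : + 2 ∣ₛ x₁ → ⊥
  x₁-even 2∣x₁ = integral-at-2-even-x₁-odd-x₂ b1 b2 x₁ x₂ 4∣b2-1 e₁ (2∣x⇒4∣x² 2∣x₁)
    (integral-at-2-even-x₁-even-x₂ b1 b2 x₁ x₂ e₁ (2∣x⇒4∣x² 2∣x₁))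
  x₁-odd : ¬ (+ 2 ∣ₛ x₁) → ⊥
  x₁-odd 2∤x₁ = uncurry (integral-at-2-even-x₂x₃ n b1 b2 x₁ x₂ x₃ 2∤n s)
    (integral-at-2-odd-x₁⇒even n b1 b2 x₁ x₂ x₃ 2∤n 2∤b1 (4∣b-1⇒odd 4∣b2-1) 2∤x₁ s)

primitive-at-2-even-x₁⇒even : ∀ n b1 b2 W x₁ x₂ x₃ → ¬ (+ 2 ∣ₛ b1) → ¬ (+ 2 ∣ₛ b2) → + 2 ∣ₛ W →
                              Solves (+ 8) n b1 b2 W x₁ x₂ x₃ → + 2 ∣ₛ x₁ → + 2 ∣ₛ x₂ × + 2 ∣ₛ x₃
primitive-at-2-even-x₁⇒even n b1 b2 W x₁ x₂ x₃ 2∤b1 2∤b2 2∣W (e₁ , e₂) 2∣x₁ =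
  prime∣a*x*x⇒∣x prime[2] 2∤b2 (∣-linear₃ (8∣⇒2∣ e₁) 2∣b1x₁² 2∣W -1ℤ 1ℤ -1ℤ (identity₂ b1 b2 x₁ x₂ W)) ,
  prime∣a*b*x*x⇒∣x prime[2] 2∤b1 2∤b2 (∣-linear₃ (8∣⇒2∣ e₂) 2∣b1x₁² (ℤD.∣n⇒∣m*n (+ n * + n) 2∣W) -1ℤ 1ℤ 1ℤ
    (identity₃ b1 b2 x₁ x₃ (+ n) W))
  where
  2∣b1x₁² : + 2 ∣ₛ b1 * x₁ * x₁
  2∣b1x₁² = ℤD.∣n⇒∣m*n (b1 * x₁) 2∣x₁
  identity₂ : ∀ b1 b2 x₁ x₂ W → b2 * x₂ * x₂ ≡ -1ℤ * (b1 * x₁ * x₁ - b2 * x₂ * x₂ - W) + 1ℤ * (b1 * x₁ * x₁) + -1ℤ * W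
  identity₂ = solve-∀
  identity₃ : ∀ b1 b2 x₁ x₃ N W → b1 * b2 * x₃ * x₃
    ≡ -1ℤ * (b1 * x₁ * x₁ - b1 * b2 * x₃ * x₃ + N * N * W) + 1ℤ * (b1 * x₁ * x₁) + 1ℤ * (N * N * W)
  identity₃ = solve-∀

primitive-at-2-odd-x₁⇒b1≡1[8] : ∀ n b1 b2 W x₁ x₂ x₃ → ¬ (+ 2 ∣ₛ + n) → ¬ (+ 2 ∣ₛ b1) → + 4 ∣ₛ b2 - 1ℤ →
                                + 2 ∣ₛ W → Solves (+ 8) n b1 b2 W x₁ x₂ x₃ → ¬ (+ 2 ∣ₛ x₁) → + 8 ∣ₛ b1 - 1ℤ
primitive-at-2-odd-x₁⇒b1≡1[8] n b1 b2 W x₁ x₂ x₃ 2∤n 2∤b1 4∣b2-1 2∣W (e₁ , e₂) 2∤x₁ =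
  ∣-linear₃ b1≡b2+W b1≡b1b2-W 8∣[b2-1][b1+1] 1ℤ 1ℤ 1ℤ (identity b1 b2 W)
  where
  2∤b1x₁² : ¬ (+ 2 ∣ₛ b1 * x₁ * x₁)
  2∤b1x₁² d = 2∤x₁ (prime∣a*x*x⇒∣x prime[2] 2∤b1 d)
  2∤x₂ : ¬ (+ 2 ∣ₛ x₂)
  2∤x₂ 2∣x₂ = 2∤b1x₁² (∣-linear₃ (8∣⇒2∣ e₁) (ℤD.∣n⇒∣m*n (b2 * x₂) 2∣x₂) 2∣W 1ℤ 1ℤ 1ℤ (identity₂ b1 b2 x₁ x₂ W))
    where
    identity₂ : ∀ b1 b2 x₁ x₂ W → b1 * x₁ * x₁ ≡ 1ℤ * (b1 * x₁ * x₁ - b2 * x₂ * x₂ - W) + 1ℤ * (b2 * x₂ * x₂) + 1ℤ * W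
    identity₂ = solve-∀
  2∤x₃ : ¬ (+ 2 ∣ₛ x₃)
  2∤x₃ 2∣x₃ = 2∤b1x₁² (∣-linear₃ (8∣⇒2∣ e₂) (ℤD.∣n⇒∣m*n (b1 * b2 * x₃) 2∣x₃) (ℤD.∣n⇒∣m*n (+ n * + n) 2∣W)
    1ℤ 1ℤ -1ℤ (identity₃ b1 b2 x₁ x₃ (+ n) W))
    where
    identity₃ : ∀ b1 b2 x₁ x₃ N W → b1 * x₁ * x₁
      ≡ 1ℤ * (b1 * x₁ * x₁ - b1 * b2 * x₃ * x₃ + N * N * W) + 1ℤ * (b1 * b2 * x₃ * x₃) + -1ℤ * (N * N * W)
    identity₃ = solve-∀
  b1≡b2+W : + 8 ∣ₛ b1 - b2 - W
  b1≡b2+W = ∣-linear₃ e₁ (odd²≡1[8] 2∤x₁) (odd²≡1[8] 2∤x₂) 1ℤ (- b1) b2 (identity₁ b1 b2 x₁ x₂ W)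
    where
    identity₁ : ∀ b1 b2 x₁ x₂ W → b1 - b2 - W
      ≡ 1ℤ * (b1 * x₁ * x₁ - b2 * x₂ * x₂ - W) + - b1 * (x₁ * x₁ - 1ℤ) + b2 * (x₂ * x₂ - 1ℤ)
    identity₁ = solve-∀
  b1≡b1b2-W : + 8 ∣ₛ b1 - b1 * b2 + W
  b1≡b1b2-W = ∣-linear₄ e₂ (odd²≡1[8] 2∤x₁) (odd²≡1[8] 2∤x₃) (odd²≡1[8] 2∤n) 1ℤ (- b1) (b1 * b2) (- W)
    (identity₂ b1 b2 x₁ x₃ (+ n) W)
    where
    identity₂ : ∀ b1 b2 x₁ x₃ N W → b1 - b1 * b2 + W
      ≡ 1ℤ * (b1 * x₁ * x₁ - b1 * b2 * x₃ * x₃ + N * N * W) + - b1 * (x₁ * x₁ - 1ℤ)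
        + b1 * b2 * (x₃ * x₃ - 1ℤ) + - W * (N * N - 1ℤ)
    identity₂ = solve-∀
  8∣[b2-1][b1+1] : + 8 ∣ₛ (b2 - 1ℤ) * (b1 + 1ℤ)
  8∣[b2-1][b1+1] = ℤD.∣-trans (ℤD.*-monoˡ-∣ (+ 2) 4∣b2-1)
    (ℤD.*-monoʳ-∣ (b2 - 1ℤ) (∣-linear₂ (odd⇒2∣x-1 2∤b1) (∣-self {+ 2} 1ℤ) 1ℤ 1ℤ (identity₃ b1)))
    where
    identity₃ : ∀ b → b + 1ℤ ≡ 1ℤ * (b - 1ℤ) + 1ℤ * (1ℤ * + 2)
    identity₃ = solve-∀
  identity : ∀ b1 b2 W → b1 - 1ℤ ≡ 1ℤ * (b1 - b2 - W) + 1ℤ * (b1 - b1 * b2 + W) + 1ℤ * ((b2 - 1ℤ) * (b1 + 1ℤ))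
  identity = solve-∀

point-at-2⇒b1≡1[8] : ∀ {n b1 b2} → ¬ (+ 2 ∣ₛ + n) → ¬ (+ 2 ∣ₛ b1) → + 4 ∣ₛ b2 - 1ℤ →
                     LocalPoint 2 n b1 b2 → + 8 ∣ₛ b1 - 1ℤ
point-at-2⇒b1≡1[8] {n} {b1} {b2} 2∤n 2∤b1 4∣b2-1 (integral x₁ x₂ x₃ s) =
  ⊥-elim (no-integral-point-at-2 n b1 b2 x₁ x₂ x₃ 2∤n 2∤b1 4∣b2-1 s)
point-at-2⇒b1≡1[8] {n} {b1} {b2} 2∤n 2∤b1 4∣b2-1 (primitive-triple W x₁ x₂ x₃ 4∣W s 2∤triple) =
  [ (λ 2∣x₁ → ⊥-elim (2∤triple (2∣x₁ , primitive-at-2-even-x₁⇒even n b1 b2 W x₁ x₂ x₃ 2∤b1 2∤b2 2∣W s 2∣x₁)))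
  , primitive-at-2-odd-x₁⇒b1≡1[8] n b1 b2 W x₁ x₂ x₃ 2∤n 2∤b1 4∣b2-1 2∣W s ]′ (toSum (2 ∣?ₛ x₁))
  where
  2∣W = 4∣⇒2∣ 4∣W
  2∤b2 = 4∣b-1⇒odd 4∣b2-1

-- Counting prime factors ≡ 5 (mod 8)

module _ {P : Pred ℕ 0ℓ} (P? : Decidable P) where

  indicator : ℕ → ℕ
  indicator x with P? x
  ... | yes _ = 1
  ... | no _ = 0

  countBelow : ℕ → ℕ
  countBelow zero = 0
  countBelow (suc N) = countBelow N ℕ.+ indicator N

  indicator-yes : ∀ {x} → P x → indicator x ≡ 1
  indicator-yes {x} px with P? x
  ... | yes _ = refl
  ... | no ¬px = ⊥-elim (¬px px)

  indicator-no : ∀ {x} → ¬ P x → indicator x ≡ 0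
  indicator-no {x} ¬px with P? x
  ... | yes px = ⊥-elim (¬px px)
  ... | no _ = refl

  length-filter-upTo : ∀ N → length (filter P? (upTo N)) ≡ countBelow N
  length-filter-upTo zero = refl
  length-filter-upTo (suc N) = begin
    length (filter P? (upTo (suc N)))                       ≡⟨ cong (length ∘′ filter P?) (ListP.upTo-∷ʳ N) ⟨
    length (filter P? (upTo N ++ N ∷ []))                   ≡⟨ cong length (ListP.filter-++ P? (upTo N) (N ∷ [])) ⟩
    length (filter P? (upTo N) ++ filter P? (N ∷ []))       ≡⟨ ListP.length-++ (filter P? (upTo N)) ⟩
    length (filter P? (upTo N)) ℕ.+ length (filter P? (N ∷ [])) ≡⟨ cong₂ ℕ._+_ (length-filter-upTo N) singleton ⟩
    countBelow N ℕ.+ indicator N                              ∎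
    where
    open ≡-Reasoning
    singleton : length (filter P? (N ∷ [])) ≡ indicator N
    singleton with P? N
    ... | yes _ = refl
    ... | no _ = refl

  countBelow-none : ∀ N → (∀ x → x < N → ¬ P x) → countBelow N ≡ 0
  countBelow-none zero _ = refl
  countBelow-none (suc N) none =
    cong₂ ℕ._+_ (countBelow-none N (λ x x<N → none x (ℕP.m<n⇒m<1+n x<N))) (indicator-no (none N ℕP.≤-refl))

  countBelow-stable : ∀ N → (∀ x → N ≤ x → ¬ P x) → ∀ M → N ≤ M → countBelow M ≡ countBelow N
  countBelow-stable N none M N≤M with ℕP.m≤n⇒m<n∨m≡n N≤M
  ... | inj₂ refl = refl
  countBelow-stable N none (suc M) _ | inj₁ (ℕ.s≤s N≤M) =
    trans (cong₂ ℕ._+_ (countBelow-stable N none M N≤M) (indicator-no (none M N≤M))) (ℕP.+-identityʳ _)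

countBelow-+ : ∀ {P Q R : Pred ℕ 0ℓ} (P? : Decidable P) (Q? : Decidable Q) (R? : Decidable R) N →
               (∀ x → indicator P? x ≡ indicator Q? x ℕ.+ indicator R? x) →
               countBelow P? N ≡ countBelow Q? N ℕ.+ countBelow R? N
countBelow-+ P? Q? R? zero _ = refl
countBelow-+ P? Q? R? (suc N) split rewrite countBelow-+ P? Q? R? N split | split N =
  +-interchange (countBelow Q? N) (countBelow R? N) (indicator Q? N) (indicator R? N)

PrimeFactor≡5[8] : ℕ → Pred ℕ 0ℓ
PrimeFactor≡5[8] m p = Prime p × p ℕD.∣ m × p % 8 ≡ 5

primeFactor≡5[8]? : ∀ m → Decidable (PrimeFactor≡5[8] m)
primeFactor≡5[8]? m p = prime? p ×-dec (p ℕD.∣? m) ×-dec (p % 8 ℕ.≟ 5)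

≡5[8] : ℕ → Pred ℕ 0ℓ
≡5[8] p x = x ≡ p × x % 8 ≡ 5

≡5[8]? : ∀ p → Decidable (≡5[8] p)
≡5[8]? p x = (x ℕ.≟ p) ×-dec (x % 8 ℕ.≟ 5)

prime∣prime⇒≡ : ∀ {x p} → Prime x → Prime p → x ℕD.∣ p → x ≡ p
prime∣prime⇒≡ px pp x∣p with prime⇒irreducible pp x∣p
... | inj₁ refl = ⊥-elim (¬prime[1] px)
... | inj₂ x≡p = x≡p

indicator-* : ∀ {p m} → Prime p → ¬ (p ℕD.∣ m) → ∀ x →
  indicator (primeFactor≡5[8]? (p ℕ.* m)) x ≡ indicator (primeFactor≡5[8]? m) x ℕ.+ indicator (≡5[8]? p) x
indicator-* {p} {m} pp p∤m x with primeFactor≡5[8]? (p ℕ.* m) x | primeFactor≡5[8]? m x | ≡5[8]? p x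
... | yes _ | yes (_ , x∣m , _) | yes (refl , _) = ⊥-elim (p∤m x∣m)
... | yes _ | yes _ | no _ = refl
... | yes _ | no _ | yes _ = refl
... | yes (px , x∣pm , x≡5) | no ¬x∣m | no x≢p with euclidsLemma p m px x∣pm
...   | inj₁ x∣p = ⊥-elim (x≢p (prime∣prime⇒≡ px pp x∣p , x≡5))
...   | inj₂ x∣m = ⊥-elim (¬x∣m (px , x∣m , x≡5))
indicator-* {p} {m} pp p∤m x | no ¬x∣pm | yes (px , x∣m , x≡5) | _ =
  ⊥-elim (¬x∣pm (px , ℕD.∣-trans x∣m (ℕD.n∣m*n p) , x≡5))
indicator-* {p} {m} pp p∤m x | no ¬x∣pm | no _ | yes (refl , x≡5) = ⊥-elim (¬x∣pm (pp , ℕD.m∣m*n m , x≡5))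
indicator-* pp p∤m x | no _ | no _ | no _ = refl

count≡5[8] : ℕ → ℕ
count≡5[8] m = countBelow (primeFactor≡5[8]? m) (suc m)

count≡5[8]-* : ∀ {p m} → Prime p → ¬ (p ℕD.∣ m) → 1 ≤ m → count≡5[8] (p ℕ.* m) ≡ count≡5[8] m ℕ.+ indicator (≡5[8]? p) p
count≡5[8]-* {p} {m} pp p∤m 1≤m = begin
  count≡5[8] (p ℕ.* m)
    ≡⟨ countBelow-+ _ _ (≡5[8]? p) (suc (p ℕ.* m)) (indicator-* pp p∤m) ⟩
  countBelow (primeFactor≡5[8]? m) (suc (p ℕ.* m)) ℕ.+ countBelow (≡5[8]? p) (suc (p ℕ.* m))
    ≡⟨ cong₂ ℕ._+_ no-factor-above-m only-p-itself ⟩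
  count≡5[8] m ℕ.+ (countBelow (≡5[8]? p) p ℕ.+ indicator (≡5[8]? p) p)
    ≡⟨ cong (λ c → count≡5[8] m ℕ.+ (c ℕ.+ indicator (≡5[8]? p) p)) none-below-p ⟩
  count≡5[8] m ℕ.+ indicator (≡5[8]? p) p
    ∎
  where
  open ≡-Reasoning
  instance
    _ = ℕ.>-nonZero 1≤m
    _ = prime⇒nonZero pp
  no-factor-above-m : countBelow (primeFactor≡5[8]? m) (suc (p ℕ.* m)) ≡ count≡5[8] m
  no-factor-above-m = countBelow-stable _ (suc m) (λ x m<x (_ , x∣m , _) → ℕP.<⇒≱ m<x (ℕD.∣⇒≤ x∣m))
    (suc (p ℕ.* m)) (ℕ.s≤s (ℕP.m≤n*m m p))
  only-p-itself : countBelow (≡5[8]? p) (suc (p ℕ.* m)) ≡ countBelow (≡5[8]? p) (suc p)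
  only-p-itself = countBelow-stable _ (suc p) (λ x p<x (x≡p , _) → ℕP.<-irrefl (sym x≡p) p<x)
    (suc (p ℕ.* m)) (ℕ.s≤s (ℕP.m≤m*n p m))
  none-below-p : countBelow (≡5[8]? p) p ≡ 0
  none-below-p = countBelow-none _ p (λ x x<p (x≡p , _) → ℕP.<-irrefl x≡p x<p)

OddNat : ℕ → Set
OddNat k = ∃ λ j → k ≡ suc (j ℕ.+ j)

%8⇒8∣ : ∀ p {r} → p % 8 ≡ r → + 8 ∣ₛ + p - + r
%8⇒8∣ p {r} p%8≡r = divides (+ (p ℕ./ 8)) (begin
  + p - + r                        ≡⟨ cong (λ x → + x - + r) (trans (ℕDM.m≡m%n+[m/n]*n p 8) (cong (ℕ._+ p ℕ./ 8 ℕ.* 8) p%8≡r)) ⟩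
  + (r ℕ.+ p ℕ./ 8 ℕ.* 8) - + r        ≡⟨ cong (_- + r) (ℤP.pos-+ r (p ℕ./ 8 ℕ.* 8)) ⟩
  + r + + (p ℕ./ 8 ℕ.* 8) - + r     ≡⟨ cancel (+ r) (+ (p ℕ./ 8 ℕ.* 8)) ⟩
  + (p ℕ./ 8 ℕ.* 8)                  ≡⟨ ℤP.pos-* (p ℕ./ 8) 8 ⟩
  + (p ℕ./ 8) * + 8              ∎)
  where
  open ≡-Reasoning
  cancel : ∀ a b → a + b - a ≡ b
  cancel = solve-∀

-- Since 5² ≡ 1 (mod 8), a product of primes ≡ 1, 5 (mod 8) is ≡ 5^c with c the number of factors ≡ 5.
ResidueMatchesCount : ℕ → Set
ResidueMatchesCount m = (+ 8 ∣ₛ + m - 1ℤ × EvenNat (count≡5[8] m)) ⊎ (+ 8 ∣ₛ + m - + 5 × OddNat (count≡5[8] m))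

residue-* : ∀ {p m} → Prime p → ¬ (p ℕD.∣ m) → 1 ≤ m → p % 8 ≡ 1 ⊎ p % 8 ≡ 5 →
            ResidueMatchesCount m → ResidueMatchesCount (p ℕ.* m)
residue-* {p} {m} pp p∤m 1≤m p-res r rewrite count≡5[8]-* pp p∤m 1≤m = combine p-res r
  where
  cast : ∀ r → + 8 ∣ₛ + p * + m - r → + 8 ∣ₛ + (p ℕ.* m) - r
  cast r = subst (λ x → + 8 ∣ₛ x - r) (sym (ℤP.pos-* p m))
  p≢5 : p % 8 ≡ 1 → ¬ ≡5[8] p p
  p≢5 p≡1 (_ , p≡5) = case trans (sym p≡1) p≡5 of λ ()
  combine : p % 8 ≡ 1 ⊎ p % 8 ≡ 5 → ResidueMatchesCount m →
            (+ 8 ∣ₛ + (p ℕ.* m) - 1ℤ × EvenNat (count≡5[8] m ℕ.+ indicator (≡5[8]? p) p))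
            ⊎ (+ 8 ∣ₛ + (p ℕ.* m) - + 5 × OddNat (count≡5[8] m ℕ.+ indicator (≡5[8]? p) p))
  combine (inj₁ p≡1) (inj₁ (m≡1 , j , c≡2j)) rewrite indicator-no (≡5[8]? p) (p≢5 p≡1) =
    inj₁ (cast 1ℤ (∣-linear₂ (%8⇒8∣ p p≡1) m≡1 (+ m) 1ℤ (identity (+ p) (+ m))) , j , trans (ℕP.+-identityʳ _) c≡2j)
    where
    identity : ∀ a b → a * b - 1ℤ ≡ b * (a - 1ℤ) + 1ℤ * (b - 1ℤ)
    identity = solve-∀
  combine (inj₁ p≡1) (inj₂ (m≡5 , j , c≡2j+1)) rewrite indicator-no (≡5[8]? p) (p≢5 p≡1) =
    inj₂ (cast (+ 5) (∣-linear₂ (%8⇒8∣ p p≡1) m≡5 (+ m) 1ℤ (identity (+ p) (+ m))) , j , trans (ℕP.+-identityʳ _) c≡2j+1)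
    where
    identity : ∀ a b → a * b - + 5 ≡ b * (a - 1ℤ) + 1ℤ * (b - + 5)
    identity = solve-∀
  combine (inj₂ p≡5) (inj₁ (m≡1 , j , c≡2j)) rewrite indicator-yes (≡5[8]? p) (refl , p≡5) =
    inj₂ (cast (+ 5) (∣-linear₂ (%8⇒8∣ p p≡5) m≡1 (+ m) (+ 5) (identity (+ p) (+ m))) ,
          j , trans (cong (ℕ._+ 1) c≡2j) (ℕP.+-comm _ 1))
    where
    identity : ∀ a b → a * b - + 5 ≡ b * (a - + 5) + + 5 * (b - 1ℤ)
    identity = solve-∀
  combine (inj₂ p≡5) (inj₂ (m≡5 , j , c≡2j+1)) rewrite indicator-yes (≡5[8]? p) (refl , p≡5) =
    inj₁ (cast 1ℤ (∣-linear₃ (%8⇒8∣ p p≡5) m≡5 (∣-self {+ 8} (+ 3)) (+ m) (+ 5) 1ℤ (identity (+ p) (+ m))) , suc j ,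
          trans (cong (ℕ._+ 1) c≡2j+1) (trans (ℕP.+-comm _ 1) (cong suc (sym (ℕP.+-suc j j)))))
    where
    identity : ∀ a b → a * b - 1ℤ ≡ b * (a - + 5) + + 5 * (b - + 5) + 1ℤ * (+ 3 * + 8)
    identity = solve-∀

SquareFreeℕ : ℕ → Set
SquareFreeℕ m = ∀ p → Prime p → ¬ (p ℕ.* p ℕD.∣ m)

∃prime-factor : ∀ m → 2 ≤ m → ∃ λ p → Prime p × p ℕD.∣ m
∃prime-factor m 2≤m with factorise m {{ℕ.>-nonZero (ℕP.<-trans (ℕ.s≤s ℕ.z≤n) 2≤m)}}
... | record { factors = [] ; isFactorisation = m≡1 } = ⊥-elim (ℕP.<-irrefl (sym m≡1) 2≤m)
... | record { factors = p ∷ ps ; isFactorisation = m≡p*ps ; factorsPrime = pp ∷ _ } =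
  p , pp , subst (p ℕD.∣_) (sym m≡p*ps) (ℕD.m∣m*n _)

squarefree⇒residueMatchesCount : ∀ m → 1 ≤ m → SquareFreeℕ m → (∀ p → Prime p → p ℕD.∣ m → p % 8 ≡ 1 ⊎ p % 8 ≡ 5) →
                                 ResidueMatchesCount m
squarefree⇒residueMatchesCount = <-rec _ go
  where
  go : ∀ m → (∀ {m′} → m′ < m → 1 ≤ m′ → SquareFreeℕ m′ → (∀ p → Prime p → p ℕD.∣ m′ → p % 8 ≡ 1 ⊎ p % 8 ≡ 5) →
                     ResidueMatchesCount m′) →
       1 ≤ m → SquareFreeℕ m → (∀ p → Prime p → p ℕD.∣ m → p % 8 ≡ 1 ⊎ p % 8 ≡ 5) → ResidueMatchesCount m
  go (suc zero) _ _ _ _ = inj₁ (divides (+ 0) refl , 0 , refl)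
  go m@(suc (suc k)) ih _ sqf good with ∃prime-factor m (ℕ.s≤s (ℕ.s≤s ℕ.z≤n))
  ... | p , pp , ℕD.divides m′ m≡m′p = subst ResidueMatchesCount (sym m≡pm′)
    (residue-* pp p∤m′ 1≤m′ (good p pp (ℕD.divides m′ m≡m′p))
      (ih m′<m 1≤m′ (λ r pr r²∣m′ → sqf r pr (ℕD.∣-trans r²∣m′ m′∣m)) (λ r pr r∣m′ → good r pr (ℕD.∣-trans r∣m′ m′∣m))))
    where
    m≡pm′ : m ≡ p ℕ.* m′
    m≡pm′ = trans m≡m′p (ℕP.*-comm m′ p)
    1≤m′ : 1 ≤ m′
    1≤m′ = ℕP.n≢0⇒n>0 λ { refl → case m≡m′p of λ () }
    p∤m′ : ¬ (p ℕD.∣ m′)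
    p∤m′ (ℕD.divides c m′≡cp) = sqf p pp (ℕD.divides c (trans m≡m′p (trans (cong (ℕ._* p) m′≡cp) (ℕP.*-assoc c p p))))
    m′<m : m′ < m
    m′<m = subst (m′ <_) (sym m≡m′p) (ℕP.m<m*n m′ p {{ℕ.>-nonZero 1≤m′}} (prime>1 pp))
    m′∣m : m′ ℕD.∣ m
    m′∣m = ℕD.divides p m≡pm′

parity : ∀ h → ∃ λ j → h ≡ j ℕ.+ j ⊎ h ≡ suc (j ℕ.+ j)
parity zero = 0 , inj₁ refl
parity (suc h) with parity h
... | j , inj₁ h≡2j = j , inj₂ (cong suc h≡2j)
... | j , inj₂ h≡2j+1 = suc j , inj₁ (trans (cong suc h≡2j+1) (cong suc (sym (ℕP.+-suc j j))))

[-1]^odd : ∀ j → -1ℤ ^ suc (j ℕ.+ j) ≡ -1ℤ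
[-1]^odd j = cong (-1ℤ ℤ.*_) (trans (^-double -1ℤ j) (ℤP.^-zeroˡ j))

≡1[4]⇒≡1∨5[8] : ∀ t → suc (t ℕ.+ t ℕ.+ (t ℕ.+ t)) % 8 ≡ 1 ⊎ suc (t ℕ.+ t ℕ.+ (t ℕ.+ t)) % 8 ≡ 5
≡1[4]⇒≡1∨5[8] t with parity t
... | j , inj₁ refl = inj₁ (trans (cong (_% 8) (form j)) (ℕDM.[m+kn]%n≡m%n 1 j 8))
  where
  form : ∀ j → suc (j ℕ.+ j ℕ.+ (j ℕ.+ j) ℕ.+ (j ℕ.+ j ℕ.+ (j ℕ.+ j))) ≡ 1 ℕ.+ j ℕ.* 8
  form = ℕSolver.solve-∀
... | j , inj₂ refl = inj₂ (trans (cong (_% 8) (form j)) (ℕDM.[m+kn]%n≡m%n 5 j 8))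
  where
  form : ∀ j → suc (suc (j ℕ.+ j) ℕ.+ suc (j ℕ.+ j) ℕ.+ (suc (j ℕ.+ j) ℕ.+ suc (j ℕ.+ j))) ≡ 5 ℕ.+ j ℕ.* 8
  form = ℕSolver.solve-∀

≡5[8]⇒form : ∀ {p} → p % 8 ≡ 5 → ∃ λ k → p ≡ suc (k ℕ.+ k ℕ.+ (k ℕ.+ k)) × -1ℤ ^ k ≡ -1ℤ
≡5[8]⇒form {p} p%8≡5 = suc (c ℕ.+ c) , trans (ℕDM.m≡m%n+[m/n]*n p 8) (trans (cong (ℕ._+ c ℕ.* 8) p%8≡5) (form c)) ,
  [-1]^odd c
  where
  c = p ℕ./ 8
  form : ∀ c → 5 ℕ.+ c ℕ.* 8 ≡ suc (suc (c ℕ.+ c) ℕ.+ suc (c ℕ.+ c) ℕ.+ (suc (c ℕ.+ c) ℕ.+ suc (c ℕ.+ c)))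
  form = ℕSolver.solve-∀

q≡1[4] : ∀ {n q} → n % 2 ≡ 1 → n ℕ.* n ℕ.+ 1 ≡ 2 ℕ.* q → ∃ λ t → q ≡ suc (t ℕ.+ t ℕ.+ (t ℕ.+ t))
q≡1[4] {n} {q} n%2≡1 n²+1≡2q with parity (n ℕ./ 2)
... | j , inj₁ n/2≡2j = j ℕ.* j ℕ.* 2 ℕ.+ j , ℕP.*-cancelˡ-≡ q _ 2 (trans (sym n²+1≡2q)
  (trans (cong (λ m → m ℕ.* m ℕ.+ 1) (trans (ℕDM.m≡m%n+[m/n]*n n 2) (cong₂ (λ a b → a ℕ.+ b ℕ.* 2) n%2≡1 n/2≡2j))) (form j)))
  where
  form : ∀ j → (1 ℕ.+ (j ℕ.+ j) ℕ.* 2) ℕ.* (1 ℕ.+ (j ℕ.+ j) ℕ.* 2) ℕ.+ 1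
             ≡ 2 ℕ.* suc (j ℕ.* j ℕ.* 2 ℕ.+ j ℕ.+ (j ℕ.* j ℕ.* 2 ℕ.+ j) ℕ.+ (j ℕ.* j ℕ.* 2 ℕ.+ j ℕ.+ (j ℕ.* j ℕ.* 2 ℕ.+ j)))
  form = ℕSolver.solve-∀
... | j , inj₂ n/2≡2j+1 = j ℕ.* j ℕ.* 2 ℕ.+ j ℕ.* 3 ℕ.+ 1 , ℕP.*-cancelˡ-≡ q _ 2 (trans (sym n²+1≡2q)
  (trans (cong (λ m → m ℕ.* m ℕ.+ 1) (trans (ℕDM.m≡m%n+[m/n]*n n 2) (cong₂ (λ a b → a ℕ.+ b ℕ.* 2) n%2≡1 n/2≡2j+1))) (form j)))
  where
  form : ∀ j → (1 ℕ.+ suc (j ℕ.+ j) ℕ.* 2) ℕ.* (1 ℕ.+ suc (j ℕ.+ j) ℕ.* 2) ℕ.+ 1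
             ≡ 2 ℕ.* suc (j ℕ.* j ℕ.* 2 ℕ.+ j ℕ.* 3 ℕ.+ 1 ℕ.+ (j ℕ.* j ℕ.* 2 ℕ.+ j ℕ.* 3 ℕ.+ 1)
                         ℕ.+ (j ℕ.* j ℕ.* 2 ℕ.+ j ℕ.* 3 ℕ.+ 1 ℕ.+ (j ℕ.* j ℕ.* 2 ℕ.+ j ℕ.* 3 ℕ.+ 1)))
  form = ℕSolver.solve-∀

4∣[4t+1]-1 : ∀ t → + 4 ∣ₛ + suc (t ℕ.+ t ℕ.+ (t ℕ.+ t)) - 1ℤ
4∣[4t+1]-1 t = divides (+ t) (begin
  + suc (t ℕ.+ t ℕ.+ (t ℕ.+ t)) - 1ℤ       ≡⟨ cong (_- 1ℤ) (ℤP.pos-+ 1 (t ℕ.+ t ℕ.+ (t ℕ.+ t))) ⟩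
  1ℤ ℤ.+ + (t ℕ.+ t ℕ.+ (t ℕ.+ t)) - 1ℤ
    ≡⟨ cong (λ x → 1ℤ ℤ.+ x - 1ℤ) (trans (ℤP.pos-+ (t ℕ.+ t) (t ℕ.+ t)) (cong₂ ℤ._+_ (ℤP.pos-+ t t) (ℤP.pos-+ t t))) ⟩
  1ℤ ℤ.+ (+ t ℤ.+ + t ℤ.+ (+ t ℤ.+ + t)) - 1ℤ ≡⟨ identity (+ t) ⟩
  + t ℤ.* + 4                                ∎)
  where
  open ≡-Reasoning
  identity : ∀ t → 1ℤ ℤ.+ (t ℤ.+ t ℤ.+ (t ℤ.+ t)) - 1ℤ ≡ t ℤ.* + 4
  identity = solve-∀

odd⇒2∤ : ∀ {x} → ∣ x ∣ % 2 ≡ 1 → ¬ (+ 2 ∣ₛ x)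
odd⇒2∤ {x} x%2≡1 2∣x = case trans (sym x%2≡1) (ℕD.n∣m⇒m%n≡0 ∣ x ∣ 2 (ℤD.∣⇒∣ᵤ 2∣x)) of λ ()

prime∣odd⇒odd : ∀ {p n} → Prime p → p ℕD.∣ n → ¬ (+ 2 ∣ₛ + n) → ∃ λ h → p ≡ suc (h ℕ.+ h)
prime∣odd⇒odd {p} {n} pr p∣n 2∤n with parity p
... | h , inj₂ p≡2h+1 = h , p≡2h+1
... | h , inj₁ p≡2h = ⊥-elim (2∤n (ℤD.∣ᵤ⇒∣ (ℕD.∣-trans (ℕD.divides h (trans p≡2h (double h))) p∣n)))
  where
  double : ∀ h → h ℕ.+ h ≡ h ℕ.* 2
  double = ℕSolver.solve-∀

squarefree-power⇒1∨q : ∀ {q m} → Prime q → 1 ℕ.≤ m → SquareFreeℕ m → (∀ p → Prime p → p ℕD.∣ m → p ≡ q) →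
                       m ≡ 1 ⊎ m ≡ q
squarefree-power⇒1∨q {q} {suc zero} _ _ _ _ = inj₁ refl
squarefree-power⇒1∨q {q} {m@(suc (suc k))} prime-q _ sqf only-q with ∃prime-factor m (ℕ.s≤s (ℕ.s≤s ℕ.z≤n))
... | p , pp , ℕD.divides m′ m≡m′p = inj₂ (cofactor m′ (subst (λ r → m ≡ m′ ℕ.* r) (only-q p pp (ℕD.divides m′ m≡m′p)) m≡m′p))
  where
  cofactor : ∀ m′ → m ≡ m′ ℕ.* q → m ≡ q
  cofactor (suc zero) m≡q = trans m≡q (ℕP.+-identityʳ q)
  cofactor m′@(suc (suc _)) m≡m′q with ∃prime-factor m′ (ℕ.s≤s (ℕ.s≤s ℕ.z≤n))
  ... | r , pr , ℕD.divides c m′≡cr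
    with only-q r pr (ℕD.divides (c ℕ.* q) (trans m≡m′q (trans (cong (ℕ._* q) m′≡cr) (swap c r q))))
    where
    swap : ∀ c r q → c ℕ.* r ℕ.* q ≡ c ℕ.* q ℕ.* r
    swap = ℕSolver.solve-∀
  ... | refl = ⊥-elim (sqf r pr (ℕD.divides c (trans m≡m′q (trans (cong (ℕ._* r) m′≡cr) (ℕP.*-assoc c r r)))))

module SelmerElement {n q m1 m2 : ℕ} (n-squarefree : SquareFree (+ n)) (n%2≡1 : n % 2 ≡ 1) (prime-q : Prime q)
         (n²+1≡2q : n ℕ.* n ℕ.+ 1 ≡ 2 ℕ.* q) (1≤m1 : 1 ℕ.≤ m1) (1≤m2 : 1 ℕ.≤ m2) (m2%2≡1 : m2 % 2 ≡ 1)
         (b1-squarefree : SquareFree (+ m1)) (b2-squarefree : SquareFree (+ m2))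
         (b1-supported : SupportedOn n q (+ m1)) (b2-supported : SupportedOn n q (+ m2))
         (solvable : ∀ l → Prime l → HasQlPoint n (+ m1) (+ m2) l) where

  private
    point : ∀ l → Prime l → LocalPoint l n (+ m1) (+ m2)
    point l pr = HasQlPoint⇒LocalPoint pr (solvable l pr)

    l²∤ : ∀ {b} → SquareFree b → ∀ {l} → Prime l → ¬ (+ l ℤ.* + l ∣ₛ b)
    l²∤ sf {l} pr l²∣b = sf l pr (ℤD.∣⇒∣ᵤ l²∣b)

    2∤n : ¬ (+ 2 ∣ₛ + n)
    2∤n = odd⇒2∤ n%2≡1

    2∤b2 : ¬ (+ 2 ∣ₛ + m2)
    2∤b2 = odd⇒2∤ m2%2≡1

  2∤b1 : ¬ (+ 2 ∣ₛ + m1)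
  2∤b1 2∣b1 with exact-factor prime[2] 2∣b1 (l²∤ b1-squarefree prime[2])
  ... | α , b1≡2α , 2∤α = b1-exact⇒no-point prime[2] 2∤n 2∤α 2∤b2
    (subst (λ b → LocalPoint 2 n b (+ m2)) b1≡2α (point 2 prime[2]))

  b2-coprime-n : ∀ {l} → Prime l → l ℕD.∣ n → ¬ (+ l ∣ₛ + m2)
  b2-coprime-n pr l∣n l∣b2 with exact-factor pr l∣b2 (l²∤ b2-squarefree pr)
  ... | β , b2≡lβ , l∤β = b2-exact⇒no-point pr (ℤD.∣ᵤ⇒∣ l∣n) l∤β (l²∤ b1-squarefree pr)
    (subst (LocalPoint _ n (+ m1)) b2≡lβ (point _ pr))

  b2≡1∨q : + m2 ≡ + 1 ⊎ + m2 ≡ + q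
  b2≡1∨q = Sum.map (cong (λ x → + x)) (cong (λ x → + x)) (squarefree-power⇒1∨q prime-q 1≤m2
    (λ p pr p²∣b2 → b2-squarefree p pr (subst (ℕD._∣ m2) (sym (ℤP.abs-* (+ p) (+ p))) p²∣b2)) only-q)
    where
    only-q : ∀ p → Prime p → p ℕD.∣ m2 → p ≡ q
    only-q p pr p∣b2 with b2-supported p pr p∣b2
    ... | inj₁ refl = ⊥-elim (2∤b2 (ℤD.∣ᵤ⇒∣ p∣b2))
    ... | inj₂ (inj₁ p≡q) = p≡q
    ... | inj₂ (inj₂ p∣n) = ⊥-elim (b2-coprime-n pr p∣n (ℤD.∣ᵤ⇒∣ p∣b2))

  q≡1∨5[8] : q % 8 ≡ 1 ⊎ q % 8 ≡ 5
  q≡1∨5[8] = let t , q≡4t+1 = q≡1[4] {n} {q} n%2≡1 n²+1≡2q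
             in subst (λ x → x % 8 ≡ 1 ⊎ x % 8 ≡ 5) (sym q≡4t+1) (≡1[4]⇒≡1∨5[8] t)

  b1-prime-factors : ∀ p → Prime p → + p ∣ + m1 → p % 8 ≡ 1 ⊎ p % 8 ≡ 5
  b1-prime-factors p pr p∣b1 with b1-supported p pr p∣b1
  ... | inj₁ refl = ⊥-elim (2∤b1 (ℤD.∣ᵤ⇒∣ p∣b1))
  ... | inj₂ (inj₁ refl) = q≡1∨5[8]
  ... | inj₂ (inj₂ p∣n) with prime∣odd⇒odd pr p∣n 2∤n | exact-factor pr (ℤD.∣ᵤ⇒∣ p∣b1) (l²∤ b1-squarefree pr)
  ... | h , p≡2h+1 | α , b1≡pα , p∤α with b1-exact⇒-1-residue pr (ℤD.∣ᵤ⇒∣ p∣n) (l²∤ n-squarefree pr) p∤α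
                                           (b2-coprime-n pr p∣n) (subst (λ b → LocalPoint p n b (+ m2)) b1≡pα (point p pr))
  ... | u , v , p∤v , p∣u²+v² with parity h
  ...   | j , inj₂ refl = ⊥-elim (-1-nonresidue {u = u} (suc (j ℕ.+ j)) pr p≡2h+1 ([-1]^odd j) p∤v
                                     (subst (+ p ∣ₛ_) (identity u v) p∣u²+v²))
    where
    identity : ∀ u v → u ℤ.* u - -1ℤ ℤ.* (v ℤ.* v) ≡ u ℤ.* u ℤ.+ v ℤ.* v
    identity = solve-∀
  ...   | j , inj₁ refl = subst (λ x → x % 8 ≡ 1 ⊎ x % 8 ≡ 5) (sym p≡2h+1) (≡1[4]⇒≡1∨5[8] j)

  b1≡1[8] : + 8 ∣ₛ + m1 - 1ℤ
  b1≡1[8] = point-at-2⇒b1≡1[8] 2∤n 2∤b1 4∣b2-1 (point 2 prime[2])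
    where
    4∣b2-1 : + 4 ∣ₛ + m2 - 1ℤ
    4∣b2-1 with b2≡1∨q
    ... | inj₁ refl = ∣0
    ... | inj₂ refl = let t , q≡4t+1 = q≡1[4] {n} {q} n%2≡1 n²+1≡2q
                      in subst (λ x → + 4 ∣ₛ + x - 1ℤ) (sym q≡4t+1) (4∣[4t+1]-1 t)

  count≡5[8]-even : EvenNat (length (primeFactors5mod8 m1))
  count≡5[8]-even with squarefree⇒residueMatchesCount m1 1≤m1
    (λ p pr p²∣b1 → b1-squarefree p pr (subst (ℕD._∣ m1) (sym (ℤP.abs-* (+ p) (+ p))) p²∣b1))
    (λ p pr p∣b1 → b1-prime-factors p pr p∣b1)
  ... | inj₁ (_ , even) = subst EvenNat (sym (length-filter-upTo (primeFactor≡5[8]? m1) (suc m1))) even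
  ... | inj₂ (b1≡5[8] , _) = ⊥-elim (8∤4 (∣-linear₂ b1≡1[8] b1≡5[8] 1ℤ -1ℤ (identity (+ m1))))
    where
    identity : ∀ m → + 4 ≡ 1ℤ ℤ.* (m - 1ℤ) ℤ.+ -1ℤ ℤ.* (m - + 5)
    identity = solve-∀
    8∤4 : ¬ (+ 8 ∣ₛ + 4)
    8∤4 d with ℕD.∣⇒≤ (ℤD.∣⇒∣ᵤ d)
    ... | ℕ.s≤s (ℕ.s≤s (ℕ.s≤s (ℕ.s≤s ())))

2q≡n²+1 : ∀ {n q} → n ℕ.* n ℕ.+ 1 ≡ 2 ℕ.* q → + 2 ℤ.* + q ≡ + n ℤ.* + n ℤ.+ 1ℤ
2q≡n²+1 {n} {q} n²+1≡2q = begin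
  + 2 ℤ.* + q           ≡⟨ ℤP.pos-* 2 q ⟨
  + (2 ℕ.* q)           ≡⟨ cong (λ x → + x) n²+1≡2q ⟨
  + (n ℕ.* n ℕ.+ 1)     ≡⟨ ℤP.pos-+ (n ℕ.* n) 1 ⟩
  + (n ℕ.* n) ℤ.+ 1ℤ    ≡⟨ cong (ℤ._+ 1ℤ) (ℤP.pos-* n n) ⟩
  + n ℤ.* + n ℤ.+ 1ℤ    ∎
  where open ≡-Reasoning

[1,q]∉Selmer : ∀ {n q} → n ℕ.* n ℕ.+ 1 ≡ 2 ℕ.* q → (Σ ℕ λ p → Prime p × p ℕD.∣ n × p % 8 ≡ 5) →
               ¬ InSelmer n q (+ 1) (+ q)
[1,q]∉Selmer {n} {q} n²+1≡2q (p , pr , p∣n , p%8≡5) (_ , _ , _ , _ , _ , solvable)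
  with ≡5[8]⇒form {p} p%8≡5
     | point-on-C[1,q]⇒±2-residue pr {n} {+ q} (ℤD.∣ᵤ⇒∣ p∣n) (2q≡n²+1 {n} {q} n²+1≡2q)
         (HasQlPoint⇒LocalPoint pr {n} {+ 1} {+ q} (solvable p pr))
... | k , p≡4k+1 , k-odd | t , t≡±2 , u , v , p∤v , p∣u²-tv² =
  ±2-nonresidue {u = u} k pr p≡4k+1 k-odd t≡±2 p∤v p∣u²-tv²

lemma2p2 : (n q : ℕ) → (b1 b2 : ℤ) →
  ℕ.NonZero n → SquareFree (+ n) → n % 2 ≡ 1 →
  Prime q → n ℕ.* n ℕ.+ 1 ≡ 2 ℕ.* q →
  ℤ.+0 ℤ.< b1 → ℤ.+0 ℤ.< b2 → ∣ b2 ∣ % 2 ≡ 1 →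
  SquareFree b1 → SquareFree b2 → SupportedOn n q b1 → SupportedOn n q b2 →
  InSelmer n q b1 b2 →
    (∀ (p : ℕ) → Prime p → (+ p) ∣ b1 → (p % 8 ≡ 1) ⊎ (p % 8 ≡ 5))
    × ((b2 ≡ + 1) ⊎ (b2 ≡ + q))
    × ((Σ ℕ λ p → Prime p × (p ℕD.∣ n) × (p % 8 ≡ 5)) → ¬ InSelmer n q (+ 1) (+ q))
    × EvenNat (length (primeFactors5mod8 ∣ b1 ∣))
lemma2p2 _ _ -[1+ _ ] _ _ _ _ _ _ () _ _ _ _ _ _ _
lemma2p2 _ _ (+ _) -[1+ _ ] _ _ _ _ _ _ () _ _ _ _ _ _
-- Unused: n ≠ 0 (n is odd), the real point (no condition when b1, b2 > 0), and the copies of the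
-- square-freeness and support hypotheses inside InSelmer.
lemma2p2 n q (+ m1) (+ m2) _ n-sf n-odd prime-q n²+1≡2q (ℤ.+<+ 0<m1) (ℤ.+<+ 0<m2) b2-odd b1-sf b2-sf b1-supp b2-supp
         (_ , _ , _ , _ , _ , solvable) =
  b1-prime-factors , b2≡1∨q , [1,q]∉Selmer n²+1≡2q , count≡5[8]-even
  where
  open SelmerElement n-sf n-odd prime-q n²+1≡2q 0<m1 0<m2 b2-odd b1-sf b2-sf b1-supp b2-supp solvable
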